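{- Let $k\ge1$ and let $F_n^K(\mathbf z;q)=\sum_{\pi\in LP_n^K}\big(\prod_j z_{\ell_j}\big)q^{\mathrm{maj}(\pi)}$ as in the context. Then for all $m,n\ge1$, $$F_{m+n}^k(\mathbf z;q)=F_m^k(\mathbf z;q)F_n^k(\mathbf zq^m;q)+\sum_{i=2}^k\sum_{j=1}^{i-1}z_i\,q^{m-j}F_{m-j}^k(\mathbf z;q)F_{n-i+j}^k(\mathbf zq^{m+i-j};q);$$ for all $n\ge1$, $$F_n^k(\mathbf z;q)=F_n^{k-1}(\mathbf z;q)+\sum_{j=0}^{n-k}z_k\,q^{j}F_j^{k-1}(\mathbf z;q)F_{n-k-j}^k(\mathbf zq^{k+j};q);$$ and for all $n\ge1$, the $k\times k$ matrix $M$ with entries $M_{s,t}=F^k_{n+k-1+t-s}(\mathbf zq^{s-1};q)$ ($1\le s,t\le k$) satisfies $$\det M=\begin{cases}z_k^{n+k-1}q^{\binom{n+k-1}{2}}&\text{if }k\text{ is odd},\\(-1)^{n-1}z_k^{n+k-1}q^{\binom{n+k-1}{2}}&\text{if }k\text{ is even}.\end{cases}$$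
   Context: For a composition $(\ell_1,\dots,\ell_r)$ of $n$, the layered permutation of $[n]$ has first $\ell_1$ entries the $\ell_1$ largest elements of $[n]$ in increasing order, next $\ell_2$ entries the next $\ell_2$ largest in increasing order, etc.; these blocks are its layers. For $K\ge0$, $LP_n^K$ is the set of layered permutations of $[n]$ with all layers of length at most $K$. $\mathbf z=(z_1,\dots,z_k)$ are indeterminates and $F_n^K(\mathbf z;q)$ is a polynomial in them and $q$; $F_n^K(\mathbf zq^m;q)$ denotes the substitution $z_i\mapsto z_iq^m$ for all $i$. $\mathrm{maj}(\pi)$ is the sum of all $i$ with $\pi(i)>\pi(i+1)$. Conventions: $F_0^K=1$, $F_n^K=0$ for $n<0$. -}

module Defs where

open import Level using (Level)
open import Algebra.Bundles using (CommutativeRing)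
open import Data.Nat as ℕ using (ℕ; zero; suc; _∸_; _≤ᵇ_)
open import Data.Integer as ℤ using (ℤ; +_; -[1+_])
open import Data.Fin using (Fin; punchIn; toℕ)
import Data.Fin as Fin
open import Data.List using (List; []; _∷_; _++_; map; concatMap; filterᵇ; foldr; upTo; length)
open import Data.Bool using (Bool; true; false; if_then_else_)

-- Compositions of n with all parts in {1,…,K}, using a fuel argument
-- (fuel n suffices, since each step strictly decreases the remainder).
compsFuel : ℕ → ℕ → ℕ → List (List ℕ)
compsFuel K zero     zero    = [] ∷ []
compsFuel K zero     (suc n) = []
compsFuel K (suc f)  zero    = [] ∷ []
compsFuel K (suc f)  (suc n) =
  concatMap (λ ℓ → map (ℓ ∷_) (compsFuel K f (suc n ∸ ℓ)))
            (filterᵇ (λ ℓ → ℓ ≤ᵇ suc n) (map suc (upTo K)))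

comps : ℕ → ℕ → List (List ℕ)
comps K n = compsFuel K n n

block : ℕ → ℕ → List ℕ
block a zero    = []
block a (suc ℓ) = suc a ∷ block (suc a) ℓ

-- layeredFrom rem (ℓ₁ ∷ …): first ℓ₁ entries are the ℓ₁ largest of [rem]
-- in increasing order, then recurse on the remaining rem - ℓ₁ elements.
layeredFrom : ℕ → List ℕ → List ℕ
layeredFrom rem []       = []
layeredFrom rem (ℓ ∷ ls) = block (rem ∸ ℓ) ℓ ++ layeredFrom (rem ∸ ℓ) ls

layered : ℕ → List ℕ → List ℕ
layered n ls = layeredFrom n ls

majFrom : ℕ → List ℕ → ℕ
majFrom i []           = 0
majFrom i (a ∷ [])     = 0
majFrom i (a ∷ b ∷ w)  =
  (if b ℕ.<ᵇ a then i else 0) ℕ.+ majFrom (suc i) (b ∷ w)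

maj : List ℕ → ℕ
maj = majFrom 1

module _ {c ℓ : Level} (R : CommutativeRing c ℓ) where
  open CommutativeRing R

  pow : Carrier → ℕ → Carrier
  pow x zero    = 1#
  pow x (suc e) = x * pow x e

  sumList : List Carrier → Carrier
  sumList = foldr _+_ 0#

  sumFromTo : ℕ → ℕ → (ℕ → Carrier) → Carrier
  sumFromTo lo hi f = sumList (map (λ i → f (lo ℕ.+ i)) (upTo (suc hi ∸ lo)))

  sumℤ : ℕ → ℤ → (ℕ → Carrier) → Carrier
  sumℤ lo (+ hi)     f = sumFromTo lo hi f
  sumℤ lo -[1+ _ ]   f = 0#

  prodZ : (ℕ → Carrier) → List ℕ → Carrier
  prodZ z = foldr (λ l acc → z l * acc) 1#

  F : (K n : ℕ) → (z : ℕ → Carrier) → (q : Carrier) → Carrier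
  F K n z q = sumList (map (λ ls → prodZ z ls * pow q (maj (layered n ls))) (comps K n))

  Fℤ : (K : ℕ) → ℤ → (z : ℕ → Carrier) → (q : Carrier) → Carrier
  Fℤ K (+ n)     z q = F K n z q
  Fℤ K -[1+ _ ]  z q = 0#

  shift : (ℕ → Carrier) → Carrier → ℕ → (ℕ → Carrier)
  shift z q m i = z i * pow q m

  sumFin : (n : ℕ) → (Fin n → Carrier) → Carrier
  sumFin zero    f = 0#
  sumFin (suc n) f = f Fin.zero + sumFin n (λ i → f (Fin.suc i))

  signPow : ℕ → Carrier
  signPow e = pow (- 1#) e

  det : (n : ℕ) → (Fin n → Fin n → Carrier) → Carrier
  det zero    M = 1#
  det (suc n) M =
    sumFin (suc n) (λ j → signPow (toℕ j) * (M Fin.zero j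
                            * det n (λ r t → M (Fin.suc r) (punchIn j t))))

Car : ∀ {c ℓ} → CommutativeRing c ℓ → Set c
Car R = CommutativeRing.Carrier R

add : ∀ {c ℓ} (R : CommutativeRing c ℓ) → Car R → Car R → Car R
add R = CommutativeRing._+_ R

mul : ∀ {c ℓ} (R : CommutativeRing c ℓ) → Car R → Car R → Car R
mul R = CommutativeRing._*_ R

Eq : ∀ {c ℓ} (R : CommutativeRing c ℓ) → Car R → Car R → Set ℓ
Eq R = CommutativeRing._≈_ R

-- Everything rests on two layer-peeling recursions.  If the first layer of a
-- layered permutation has length ℓ, the remaining layers form a layered
-- permutation of n-ℓ whose descents all move ℓ places to the right; this gives
-- the first-layer recursion  F_n(z) = Σ_{ℓ ≤ K} z_ℓ F_{n-ℓ}(z q^ℓ).  Iterating it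
-- yields the last-layer recursion  F_{n+1}(z) = Σ_{ℓ ≤ K} z_ℓ q^{n+1-ℓ} F_{n+1-ℓ}(z).
-- To avoid case distinctions we work with  Fdiff A B = F_{A-B}  (zero if A < B).
--
-- (1) and (2) follow by strong induction on m (resp. n) from the first-layer
-- recursion: peel the first layer and either stay inside the first m letters
-- (resp. layers shorter than k) or cross the boundary.
-- (3): the Hankel-type matrix A_N(r,t) = F_{N+t-r}(z q^r) is unitriangular for
-- N = 0, and by the last-layer recursion the last column of A_{N+1} is a
-- combination of its other columns plus z_k q^N times the first column of A_N,
-- while its other columns are those of A_N moved one place left.  Multilinearity
-- and alternation of the determinant give det A_{N+1} = (-1)^{k-1} z_k q^N det A_N.
module Submission where

open import Defs
open import Level using (Level)
open import Algebra.Bundles using (CommutativeRing)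
open import Data.Nat using (ℕ; zero; suc; _+_; _∸_; _≤_; _<_; z≤n; s≤s; _≤ᵇ_; _<ᵇ_; _≟_; _≤?_)
import Data.Nat as ℕ
import Data.Nat.Properties as ℕₚ
open import Data.Nat.Combinatorics using (_C_; nC1≡n; nCk+nC[k+1]≡[n+1]C[k+1])
open import Data.Nat.Divisibility using (_∣_; divides)
open import Data.Nat.ListAction using (sum)
open import Data.Nat.Tactic.RingSolver using (solve-∀)
open import Data.Integer using (+_) renaming (_+_ to _+ℤ_; _-_ to _-ℤ_; -_ to -ℤ_)
import Data.Integer.Properties as ℤₚ
open import Data.Fin using (Fin; toℕ; punchIn)
import Data.Fin as Fin
open import Data.Fin.Properties using (toℕ<n)
open import Data.Bool using (Bool; true; false; if_then_else_; T)
open import Data.List using (List; []; _∷_; _++_; map; concat; concatMap; filterᵇ; upTo; length; applyUpTo)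
import Data.List.Properties as Listₚ
open import Data.List.Relation.Unary.All as All using (All; []; _∷_)
open import Data.List.Relation.Unary.All.Properties using (map⁺; concat⁺; applyUpTo⁺₂)
open import Data.Product using (_×_; _,_; Σ)
open import Data.Sum using (_⊎_; inj₁; inj₂)
open import Data.Empty using (⊥-elim)
open import Relation.Nullary using (¬_; Dec; yes; no)
open import Relation.Binary.Definitions using (tri<; tri≈; tri>)
import Relation.Binary.PropositionalEquality as P
open P using (_≡_; _≢_)
import Relation.Binary.Reasoning.Setoid as SetoidReasoning

module Sums {a ℓ : Level} (R : CommutativeRing a ℓ) where
  open CommutativeRing R hiding (zero) renaming (_+_ to _⊕_; _*_ to _⊗_)
  open import Algebra.Properties.Group +-group using (ε⁻¹≈ε)
  open import Algebra.Properties.AbelianGroup +-abelianGroup using (⁻¹-∙-comm)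
  open import Algebra.Properties.CommutativeSemigroup +-commutativeSemigroup using (interchange)
  open SetoidReasoning setoid

  ∑ : ℕ → (ℕ → Carrier) → Carrier
  ∑ zero    f = 0#
  ∑ (suc n) f = f 0 ⊕ ∑ n (λ i → f (suc i))

  ∑-cong : ∀ n {f g : ℕ → Carrier} → (∀ i → i < n → f i ≈ g i) → ∑ n f ≈ ∑ n g
  ∑-cong zero    h = refl
  ∑-cong (suc n) h = +-cong (h 0 (s≤s z≤n)) (∑-cong n (λ i p → h (suc i) (s≤s p)))

  ∑-cong′ : ∀ n {f g : ℕ → Carrier} → (∀ i → f i ≈ g i) → ∑ n f ≈ ∑ n g
  ∑-cong′ n h = ∑-cong n (λ i _ → h i)

  ∑-zero : ∀ n {f : ℕ → Carrier} → (∀ i → i < n → f i ≈ 0#) → ∑ n f ≈ 0#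
  ∑-zero zero    h = refl
  ∑-zero (suc n) h = trans (+-cong (h 0 (s≤s z≤n)) (∑-zero n (λ i p → h (suc i) (s≤s p)))) (+-identityʳ 0#)

  ∑-+ : ∀ n (f g : ℕ → Carrier) → ∑ n (λ i → f i ⊕ g i) ≈ ∑ n f ⊕ ∑ n g
  ∑-+ zero    f g = sym (+-identityʳ 0#)
  ∑-+ (suc n) f g = trans (+-cong refl (∑-+ n _ _)) (interchange _ _ _ _)

  ∑-*ˡ : ∀ n x (f : ℕ → Carrier) → ∑ n (λ i → x ⊗ f i) ≈ x ⊗ ∑ n f
  ∑-*ˡ zero    x f = sym (zeroʳ x)
  ∑-*ˡ (suc n) x f = trans (+-cong refl (∑-*ˡ n x _)) (sym (distribˡ x _ _))

  ∑-*ʳ : ∀ n x (f : ℕ → Carrier) → ∑ n (λ i → f i ⊗ x) ≈ ∑ n f ⊗ x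
  ∑-*ʳ zero    x f = sym (zeroˡ x)
  ∑-*ʳ (suc n) x f = trans (+-cong refl (∑-*ʳ n x _)) (sym (distribʳ x _ _))

  ∑-neg : ∀ n (f : ℕ → Carrier) → ∑ n (λ i → - f i) ≈ - ∑ n f
  ∑-neg zero    f = sym ε⁻¹≈ε
  ∑-neg (suc n) f = trans (+-cong refl (∑-neg n _)) (⁻¹-∙-comm _ _)

  ∑-split : ∀ a b (f : ℕ → Carrier) → ∑ (a + b) f ≈ ∑ a f ⊕ ∑ b (λ i → f (a + i))
  ∑-split zero    b f = sym (+-identityˡ _)
  ∑-split (suc a) b f = trans (+-cong refl (∑-split a b _)) (sym (+-assoc _ _ _))

  ∑-last : ∀ n (f : ℕ → Carrier) → ∑ (suc n) f ≈ ∑ n f ⊕ f n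
  ∑-last n f = begin
    ∑ (suc n) f                  ≡⟨ P.cong (λ m → ∑ m f) (ℕₚ.+-comm 1 n) ⟩
    ∑ (n + 1) f                  ≈⟨ ∑-split n 1 f ⟩
    ∑ n f ⊕ (f (n + 0) ⊕ 0#)     ≈⟨ +-cong refl (+-identityʳ _) ⟩
    ∑ n f ⊕ f (n + 0)            ≡⟨ P.cong (λ m → ∑ n f ⊕ f m) (ℕₚ.+-identityʳ n) ⟩
    ∑ n f ⊕ f n                  ∎

  ∑-comm : ∀ n m (f : ℕ → ℕ → Carrier) → ∑ n (λ i → ∑ m (f i)) ≈ ∑ m (λ j → ∑ n (λ i → f i j))
  ∑-comm zero    m f = sym (∑-zero m (λ _ _ → refl))
  ∑-comm (suc n) m f = trans (+-cong refl (∑-comm n m _)) (sym (∑-+ m _ _))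

  ∑-single : ∀ n c {f : ℕ → Carrier} → c < n → (∀ i → i < n → i ≢ c → f i ≈ 0#) → ∑ n f ≈ f c
  ∑-single (suc n) zero    _       h =
    trans (+-cong refl (∑-zero n (λ i p → h (suc i) (s≤s p) (λ ())))) (+-identityʳ _)
  ∑-single (suc n) (suc c) (s≤s p) h =
    trans (+-cong (h 0 (s≤s z≤n) (λ ())) (∑-single n c p (λ i q ne → h (suc i) (s≤s q) (λ e → ne (ℕₚ.suc-injective e))))) (+-identityˡ _)

  sumList-applyUpTo : ∀ n (g : ℕ → Carrier) → sumList R (applyUpTo g n) ≈ ∑ n g
  sumList-applyUpTo zero    g = refl
  sumList-applyUpTo (suc n) g = +-cong refl (sumList-applyUpTo n _)

  sumList-upTo : ∀ n (f : ℕ → Carrier) → sumList R (map f (upTo n)) ≈ ∑ n f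
  sumList-upTo n f = P.subst (λ l → sumList R l ≈ ∑ n f) (P.sym (Listₚ.map-upTo f n)) (sumList-applyUpTo n f)

  sumFromTo≈∑ : ∀ lo hi (f : ℕ → Carrier) → sumFromTo R lo hi f ≈ ∑ (suc hi ∸ lo) (λ i → f (lo + i))
  sumFromTo≈∑ lo hi f = sumList-upTo (suc hi ∸ lo) (λ i → f (lo + i))

  sumFin≈∑ : ∀ n (f : Fin n → Carrier) (g : ℕ → Carrier) → (∀ i → f i ≈ g (toℕ i)) → sumFin R n f ≈ ∑ n g
  sumFin≈∑ zero    f g h = refl
  sumFin≈∑ (suc n) f g h = +-cong (h Fin.zero) (sumFin≈∑ n _ _ (λ i → h (Fin.suc i)))

  sumList-++ : ∀ xs ys → sumList R (xs ++ ys) ≈ sumList R xs ⊕ sumList R ys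
  sumList-++ []       ys = sym (+-identityˡ _)
  sumList-++ (x ∷ xs) ys = trans (+-cong refl (sumList-++ xs ys)) (sym (+-assoc _ _ _))

  sumList-concatMap : ∀ {u v} {X : Set u} {Y : Set v} (f : Y → Carrier) (g : X → List Y) (xs : List X) →
    sumList R (map f (concatMap g xs)) ≈ sumList R (map (λ x → sumList R (map f (g x))) xs)
  sumList-concatMap f g []       = refl
  sumList-concatMap f g (x ∷ xs) = begin
    sumList R (map f (g x ++ concatMap g xs))
      ≡⟨ P.cong (sumList R) (Listₚ.map-++ f (g x) (concatMap g xs)) ⟩
    sumList R (map f (g x) ++ map f (concatMap g xs))
      ≈⟨ sumList-++ (map f (g x)) _ ⟩
    sumList R (map f (g x)) ⊕ sumList R (map f (concatMap g xs))
      ≈⟨ +-cong refl (sumList-concatMap f g xs) ⟩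
    sumList R (map (λ x → sumList R (map f (g x))) (x ∷ xs)) ∎

  sumList-filterᵇ : ∀ {u} {X : Set u} (p : X → Bool) (h : X → Carrier) (xs : List X) →
    sumList R (map h (filterᵇ p xs)) ≈ sumList R (map (λ x → if p x then h x else 0#) xs)
  sumList-filterᵇ p h []       = refl
  sumList-filterᵇ p h (x ∷ xs) with p x
  ... | true  = +-cong refl (sumList-filterᵇ p h xs)
  ... | false = trans (sumList-filterᵇ p h xs) (sym (+-identityˡ _))

  sumList-cong : ∀ {u} {X : Set u} (f g : X → Carrier) (xs : List X) →
    All (λ x → f x ≈ g x) xs → sumList R (map f xs) ≈ sumList R (map g xs)
  sumList-cong f g []       []       = refl
  sumList-cong f g (x ∷ xs) (p ∷ ps) = +-cong p (sumList-cong f g xs ps)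

  sumList-*ˡ : ∀ {u} {X : Set u} x (f : X → Carrier) (xs : List X) →
    sumList R (map (λ y → x ⊗ f y) xs) ≈ x ⊗ sumList R (map f xs)
  sumList-*ˡ x f []       = sym (zeroʳ x)
  sumList-*ˡ x f (y ∷ xs) = trans (+-cong refl (sumList-*ˡ x f xs)) (sym (distribˡ x _ _))

-- Determinants of ℕ-indexed matrices, defined (like `det` of the statement)
-- by Laplace expansion along the first row; only the top-left n×n block of
-- the matrix matters.
module Determinants {a ℓ : Level} (R : CommutativeRing a ℓ) where
  open CommutativeRing R hiding (zero) renaming (_+_ to _⊕_; _*_ to _⊗_)
  open Sums R
  open import Algebra.Solver.Ring.NaturalCoefficients.Default commutativeSemiring using (solve; _:+_; _:*_; _:=_)
  open import Algebra.Properties.Ring ring using (-1*x≈-x; -‿distribʳ-*)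
  open import Algebra.Properties.Group +-group using (⁻¹-involutive; ε⁻¹≈ε)
  open SetoidReasoning setoid

  sgn : ℕ → Carrier
  sgn = signPow R

  sgn-suc : ∀ j x → sgn (suc j) ⊗ x ≈ - (sgn j ⊗ x)
  sgn-suc j x = trans (*-assoc _ _ _) (-1*x≈-x _)

  sgn-pred : ∀ j x → sgn j ⊗ x ≈ - (sgn (suc j) ⊗ x)
  sgn-pred j x = trans (sym (⁻¹-involutive _)) (-‿cong (sym (sgn-suc j x)))

  *-neg : ∀ a b d → a ⊗ (b ⊗ (- d)) ≈ - (a ⊗ (b ⊗ d))
  *-neg a b d = trans (*-cong refl (sym (-‿distribʳ-* b d))) (sym (-‿distribʳ-* a _))

  vanish : ∀ {a b d} → d ≈ 0# → a ⊗ (b ⊗ d) ≈ 0#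
  vanish d≈0 = trans (*-cong refl (trans (*-cong refl d≈0) (zeroʳ _))) (zeroʳ _)

  neg≈0 : ∀ x → - x ≈ 0# → x ≈ 0#
  neg≈0 x h = trans (sym (⁻¹-involutive x)) (trans (-‿cong h) ε⁻¹≈ε)

  -- skip j t is the t-th element of ℕ ∖ {j}: the ℕ-version of punchIn,
  -- giving the columns of a minor.
  skip : ℕ → ℕ → ℕ
  skip zero    t       = suc t
  skip (suc j) zero    = zero
  skip (suc j) (suc t) = suc (skip j t)

  toℕ-punchIn : ∀ {n} (j : Fin (suc n)) (t : Fin n) → toℕ (punchIn j t) ≡ skip (toℕ j) (toℕ t)
  toℕ-punchIn Fin.zero t = P.refl
  toℕ-punchIn {suc n} (Fin.suc j) Fin.zero = P.refl
  toℕ-punchIn {suc n} (Fin.suc j) (Fin.suc t) = P.cong suc (toℕ-punchIn j t)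

  skip-injective : ∀ j t t′ → skip j t ≡ skip j t′ → t ≡ t′
  skip-injective zero    t       t′       e = ℕₚ.suc-injective e
  skip-injective (suc j) zero    zero     e = P.refl
  skip-injective (suc j) (suc t) (suc t′) e = P.cong suc (skip-injective j t t′ (ℕₚ.suc-injective e))

  skip-below : ∀ j t → t < j → skip j t ≡ t
  skip-below (suc j) zero    _       = P.refl
  skip-below (suc j) (suc t) (s≤s p) = P.cong suc (skip-below j t p)

  skip-above : ∀ j t → j ≤ t → skip j t ≡ suc t
  skip-above zero    t       _       = P.refl
  skip-above (suc j) (suc t) (s≤s p) = P.cong suc (skip-above j t p)

  skip-≢ : ∀ j t → skip j t ≢ j
  skip-≢ zero    t       ()
  skip-≢ (suc j) zero    ()
  skip-≢ (suc j) (suc t) e = skip-≢ j t (ℕₚ.suc-injective e)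

  skip-< : ∀ j t n → t < n → skip j t < suc n
  skip-< zero    t       n       p       = s≤s p
  skip-< (suc j) zero    n       p       = s≤s z≤n
  skip-< (suc j) (suc t) (suc n) (s≤s p) = s≤s (skip-< j t n p)

  skip-onto : ∀ n j c → j ≢ c → c < suc n → j < suc n → Σ ℕ (λ c′ → c′ < n × skip j c′ ≡ c)
  skip-onto n j c ne cb jb with ℕₚ.<-cmp c j
  ... | tri< c<j _ _ = c , ℕₚ.<-≤-trans c<j (ℕₚ.≤-pred jb) , skip-below j c c<j
  ... | tri≈ _ e _   = ⊥-elim (ne (P.sym e))
  ... | tri> _ _ j<c with c | cb | j<c
  ...   | suc c′ | s≤s cb′ | s≤s j≤c′ = c′ , cb′ , skip-above j c′ j≤c′

  Mat : Set a
  Mat = ℕ → ℕ → Carrier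

  minor : Mat → ℕ → Mat
  minor M j r t = M (suc r) (skip j t)

  detℕ : ℕ → Mat → Carrier
  detℕ zero    M = 1#
  detℕ (suc n) M = ∑ (suc n) (λ j → sgn j ⊗ (M 0 j ⊗ detℕ n (minor M j)))

  detℕ-cong : ∀ n (M M′ : Mat) → (∀ r t → r < n → t < n → M r t ≈ M′ r t) → detℕ n M ≈ detℕ n M′
  detℕ-cong zero    M M′ h = refl
  detℕ-cong (suc n) M M′ h =
    ∑-cong (suc n) {λ j → sgn j ⊗ (M 0 j ⊗ detℕ n (minor M j))} {λ j → sgn j ⊗ (M′ 0 j ⊗ detℕ n (minor M′ j))}
      λ j jb → *-cong refl (*-cong (h 0 j (s≤s z≤n) jb)
    (detℕ-cong n (minor M j) (minor M′ j) (λ r t rb tb → h (suc r) (skip j t) (s≤s rb) (skip-< j t n tb))))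

  detℕ-cong≡ : ∀ n (M M′ : Mat) → (∀ r t → M r t ≡ M′ r t) → detℕ n M ≈ detℕ n M′
  detℕ-cong≡ n M M′ h = detℕ-cong n M M′ (λ r t _ _ → reflexive (h r t))

  det≈detℕ : ∀ n (M : Fin n → Fin n → Carrier) (M̂ : Mat) → (∀ r t → M r t ≈ M̂ (toℕ r) (toℕ t)) →
             det R n M ≈ detℕ n M̂
  det≈detℕ zero    M M̂ h = refl
  det≈detℕ (suc n) M M̂ h =
    sumFin≈∑ (suc n) _ (λ j → sgn j ⊗ (M̂ 0 j ⊗ detℕ n (minor M̂ j))) λ j → *-cong refl (*-cong (h Fin.zero j)
      (det≈detℕ n _ (minor M̂ (toℕ j)) (λ r t →
        P.subst (λ x → M (Fin.suc r) (punchIn j t) ≈ M̂ (suc (toℕ r)) x) (toℕ-punchIn j t) (h (Fin.suc r) (punchIn j t)))))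


  setCol : Mat → ℕ → (ℕ → Carrier) → Mat
  setCol M c U r t with t ≟ c
  ... | yes _ = U r
  ... | no  _ = M r t

  setCol-at : ∀ M c U r → setCol M c U r c ≡ U r
  setCol-at M c U r with c ≟ c
  ... | yes _ = P.refl
  ... | no ne = ⊥-elim (ne P.refl)

  setCol-off : ∀ M c U r t → t ≢ c → setCol M c U r t ≡ M r t
  setCol-off M c U r t ne with t ≟ c
  ... | yes e = ⊥-elim (ne e)
  ... | no  _ = P.refl

  setCol-setCol : ∀ M c U V r t → setCol (setCol M c U) c V r t ≡ setCol M c V r t
  setCol-setCol M c U V r t with t ≟ c
  ... | yes _ = P.refl
  ... | no ne = setCol-off M c U r t ne

  minor-setCol-same : ∀ M c U r t → minor (setCol M c U) c r t ≡ minor M c r t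
  minor-setCol-same M c U r t = setCol-off M c U (suc r) (skip c t) (skip-≢ c t)

  minor-setCol : ∀ M j c c′ U → skip j c′ ≡ c →
                 ∀ r t → setCol (minor M j) c′ (λ r → U (suc r)) r t ≡ minor (setCol M c U) j r t
  minor-setCol M j c c′ U e r t with t ≟ c′
  ... | yes P.refl = P.sym (P.trans (P.cong (setCol M c U (suc r)) e) (setCol-at M c U (suc r)))
  ... | no ne = P.sym (setCol-off M c U (suc r) (skip j t) (λ e′ → ne (skip-injective j t c′ (P.trans e′ (P.sym e)))))

  -- For the expansion term of column c itself this is
  -- distributivity; for any other column j, column c survives in the minor.
  detℕ-linear : ∀ n c (M : Mat) U V x y → c < n → (∀ r → r < n → M r c ≈ x ⊗ U r ⊕ y ⊗ V r) →
                detℕ n M ≈ x ⊗ detℕ n (setCol M c U) ⊕ y ⊗ detℕ n (setCol M c V)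
  detℕ-linear (suc n) c M U V x y cb h = begin
    ∑ (suc n) (expansionTerm M)                                        ≈⟨ ∑-cong (suc n) (λ j jb → term j jb (j ≟ c)) ⟩
    ∑ (suc n) (λ j → x ⊗ tU j ⊕ y ⊗ tV j)                             ≈⟨ ∑-+ (suc n) (λ j → x ⊗ tU j) (λ j → y ⊗ tV j) ⟩
    ∑ (suc n) (λ j → x ⊗ tU j) ⊕ ∑ (suc n) (λ j → y ⊗ tV j)           ≈⟨ +-cong (∑-*ˡ (suc n) x tU) (∑-*ˡ (suc n) y tV) ⟩
    x ⊗ ∑ (suc n) tU ⊕ y ⊗ ∑ (suc n) tV                               ∎
    where
    expansionTerm : Mat → ℕ → Carrier
    expansionTerm A j = sgn j ⊗ (A 0 j ⊗ detℕ n (minor A j))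
    tU tV : ℕ → Carrier
    tU = expansionTerm (setCol M c U)
    tV = expansionTerm (setCol M c V)
    distrib₁ : ∀ s x u y v d → s ⊗ ((x ⊗ u ⊕ y ⊗ v) ⊗ d) ≈ x ⊗ (s ⊗ (u ⊗ d)) ⊕ y ⊗ (s ⊗ (v ⊗ d))
    distrib₁ = solve 6 (λ s x u y v d → s :* ((x :* u :+ y :* v) :* d) := x :* (s :* (u :* d)) :+ y :* (s :* (v :* d))) refl
    distrib₂ : ∀ s m x a y b → s ⊗ (m ⊗ (x ⊗ a ⊕ y ⊗ b)) ≈ x ⊗ (s ⊗ (m ⊗ a)) ⊕ y ⊗ (s ⊗ (m ⊗ b))
    distrib₂ = solve 6 (λ s m x a y b → s :* (m :* (x :* a :+ y :* b)) := x :* (s :* (m :* a)) :+ y :* (s :* (m :* b))) refl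
    term : ∀ j → j < suc n → Dec (j ≡ c) → expansionTerm M j ≈ x ⊗ tU j ⊕ y ⊗ tV j
    term j jb (yes P.refl) = begin
          sgn j ⊗ (M 0 j ⊗ D)                                          ≈⟨ *-cong refl (*-cong (h 0 (s≤s z≤n)) refl) ⟩
          sgn j ⊗ ((x ⊗ U 0 ⊕ y ⊗ V 0) ⊗ D)                            ≈⟨ distrib₁ _ _ _ _ _ _ ⟩
          x ⊗ (sgn j ⊗ (U 0 ⊗ D)) ⊕ y ⊗ (sgn j ⊗ (V 0 ⊗ D))            ≈⟨ +-cong (*-cong refl (same U)) (*-cong refl (same V)) ⟩
          x ⊗ tU j ⊕ y ⊗ tV j                                          ∎
      where
      D = detℕ n (minor M j)
      same : ∀ W → sgn j ⊗ (W 0 ⊗ D) ≈ expansionTerm (setCol M j W) j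
      same W = *-cong refl (*-cong (reflexive (P.sym (setCol-at M j W 0)))
                 (detℕ-cong≡ n _ _ (λ r t → P.sym (minor-setCol-same M j W r t))))
    term j jb (no ne) with skip-onto n j c ne cb jb
    ...   | c′ , c′b , e = begin
          sgn j ⊗ (M 0 j ⊗ detℕ n (minor M j))
            ≈⟨ *-cong refl (*-cong refl (detℕ-linear n c′ (minor M j) (↓ U) (↓ V) x y c′b
                 (λ r rb → P.subst (λ d → M (suc r) d ≈ x ⊗ U (suc r) ⊕ y ⊗ V (suc r)) (P.sym e) (h (suc r) (s≤s rb))))) ⟩
          sgn j ⊗ (M 0 j ⊗ (x ⊗ D U ⊕ y ⊗ D V))                        ≈⟨ distrib₂ _ _ _ _ _ _ ⟩
          x ⊗ (sgn j ⊗ (M 0 j ⊗ D U)) ⊕ y ⊗ (sgn j ⊗ (M 0 j ⊗ D V))    ≈⟨ +-cong (*-cong refl (other U)) (*-cong refl (other V)) ⟩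
          x ⊗ tU j ⊕ y ⊗ tV j                                          ∎
      where
      ↓ : (ℕ → Carrier) → (ℕ → Carrier)
      ↓ W r = W (suc r)
      D : (ℕ → Carrier) → Carrier
      D W = detℕ n (setCol (minor M j) c′ (↓ W))
      other : ∀ W → sgn j ⊗ (M 0 j ⊗ D W) ≈ expansionTerm (setCol M c W) j
      other W = *-cong refl (*-cong (reflexive (P.sym (setCol-off M c W 0 j ne)))
                  (detℕ-cong≡ n _ _ (minor-setCol M j c c′ W e)))

  detℕ-zeroColumn : ∀ n c (M : Mat) → c < n → (∀ r → r < n → M r c ≈ 0#) → detℕ n M ≈ 0#
  detℕ-zeroColumn n c M cb h =
    trans (detℕ-linear n c M (λ _ → 0#) (λ _ → 0#) 0# 0# cb (λ r rb → trans (h r rb) (sym 0·+0·≈0))) 0·+0·≈0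
    where
    0·+0·≈0 : ∀ {a b} → 0# ⊗ a ⊕ 0# ⊗ b ≈ 0#
    0·+0·≈0 = trans (+-cong (zeroˡ _) (zeroˡ _)) (+-identityʳ _)

  detℕ-linearSum : ∀ p n c (M : Mat) (a : ℕ → Carrier) (V : ℕ → ℕ → Carrier) → c < n →
    (∀ r → r < n → M r c ≈ ∑ p (λ i → a i ⊗ V i r)) → detℕ n M ≈ ∑ p (λ i → a i ⊗ detℕ n (setCol M c (V i)))
  detℕ-linearSum zero    n c M a V cb h = detℕ-zeroColumn n c M cb h
  detℕ-linearSum (suc p) n c M a V cb h = begin
    detℕ n M
      ≈⟨ detℕ-linear n c M (V 0) rest (a 0) 1# cb (λ r rb → trans (h r rb) (+-cong refl (sym (*-identityˡ _)))) ⟩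
    a 0 ⊗ detℕ n (setCol M c (V 0)) ⊕ 1# ⊗ detℕ n (setCol M c rest)
      ≈⟨ +-cong refl (trans (*-identityˡ _) (detℕ-linearSum p n c (setCol M c rest) (λ i → a (suc i)) (λ i → V (suc i)) cb
           (λ r rb → reflexive (setCol-at M c rest r)))) ⟩
    a 0 ⊗ detℕ n (setCol M c (V 0)) ⊕ ∑ p (λ i → a (suc i) ⊗ detℕ n (setCol (setCol M c rest) c (V (suc i))))
      ≈⟨ +-cong refl (∑-cong′ p (λ i → *-cong refl (detℕ-cong≡ n _ _ (setCol-setCol M c rest (V (suc i)))))) ⟩
    ∑ (suc p) (λ i → a i ⊗ detℕ n (setCol M c (V i))) ∎
    where
    rest : ℕ → Carrier
    rest r = ∑ p (λ i → a (suc i) ⊗ V (suc i) r)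

  swap : ℕ → ℕ → ℕ
  swap zero    zero                = 1
  swap zero    (suc zero)          = 0
  swap zero    (suc (suc t))       = suc (suc t)
  swap (suc c) zero                = zero
  swap (suc c) (suc t)             = suc (swap c t)

  swap-left : ∀ c → swap c c ≡ suc c
  swap-left zero    = P.refl
  swap-left (suc c) = P.cong suc (swap-left c)

  swap-right : ∀ c → swap c (suc c) ≡ c
  swap-right zero    = P.refl
  swap-right (suc c) = P.cong suc (swap-right c)

  swap-other : ∀ c t → t ≢ c → t ≢ suc c → swap c t ≡ t
  swap-other zero    zero          h₁ h₂ = ⊥-elim (h₁ P.refl)
  swap-other zero    (suc zero)    h₁ h₂ = ⊥-elim (h₂ P.refl)
  swap-other zero    (suc (suc t)) h₁ h₂ = P.refl
  swap-other (suc c) zero          h₁ h₂ = P.refl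
  swap-other (suc c) (suc t)       h₁ h₂ = P.cong suc (swap-other c t (λ e → h₁ (P.cong suc e)) (λ e → h₂ (P.cong suc e)))

  swap-skip-left : ∀ c t → swap c (skip c t) ≡ skip (suc c) t
  swap-skip-left zero    zero    = P.refl
  swap-skip-left zero    (suc t) = P.refl
  swap-skip-left (suc c) zero    = P.refl
  swap-skip-left (suc c) (suc t) = P.cong suc (swap-skip-left c t)

  swap-skip-right : ∀ c t → swap c (skip (suc c) t) ≡ skip c t
  swap-skip-right zero    zero    = P.refl
  swap-skip-right zero    (suc t) = P.refl
  swap-skip-right (suc c) zero    = P.refl
  swap-skip-right (suc c) (suc t) = P.cong suc (swap-skip-right c t)

  swap-skip-after : ∀ c j t → suc c < j → swap c (skip j t) ≡ skip j (swap c t)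
  swap-skip-after zero    (suc zero)    t             (s≤s ())
  swap-skip-after zero    (suc (suc j)) zero          _       = P.refl
  swap-skip-after zero    (suc (suc j)) (suc zero)    _       = P.refl
  swap-skip-after zero    (suc (suc j)) (suc (suc t)) _       = P.refl
  swap-skip-after (suc c) (suc j)       zero          _       = P.refl
  swap-skip-after (suc c) (suc j)       (suc t)       (s≤s p) = P.cong suc (swap-skip-after c j t p)

  swap-skip-before : ∀ c j t → j ≤ c → swap (suc c) (skip j t) ≡ skip j (swap c t)
  swap-skip-before c       zero    t       _       = P.refl
  swap-skip-before (suc c) (suc j) zero    _       = P.refl
  swap-skip-before (suc c) (suc j) (suc t) (s≤s p) = P.cong suc (swap-skip-before c j t p)

  skip-left≡skip-right : ∀ c t → t ≢ c → skip c t ≡ skip (suc c) t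
  skip-left≡skip-right zero    zero    ne = ⊥-elim (ne P.refl)
  skip-left≡skip-right zero    (suc t) ne = P.refl
  skip-left≡skip-right (suc c) zero    ne = P.refl
  skip-left≡skip-right (suc c) (suc t) ne = P.cong suc (skip-left≡skip-right c t (λ e → ne (P.cong suc e)))

  ∑-swap : ∀ n c (f : ℕ → Carrier) → suc c < n → ∑ n (λ j → f (swap c j)) ≈ ∑ n f
  ∑-swap (suc (suc n)) zero    f _       = exchange _ _ _
    where
    exchange : ∀ a b s → b ⊕ (a ⊕ s) ≈ a ⊕ (b ⊕ s)
    exchange = solve 3 (λ a b s → b :+ (a :+ s) := a :+ (b :+ s)) refl
  ∑-swap (suc n)       (suc c) f (s≤s p) = +-cong refl (∑-swap n c (λ j → f (suc j)) p)

  -- Induction on n: the terms of the expansion are permuted by the swap, the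
  -- two terms of columns c, c+1 change sign, and in the others the minors
  -- have two adjacent columns exchanged.
  detℕ-swap : ∀ n c (M : Mat) → suc c < n → detℕ n (λ r t → M r (swap c t)) ≈ - detℕ n M
  swapTerm : ∀ n c (M : Mat) → suc c < suc n → ∀ j → j < suc n →
    sgn j ⊗ (M 0 (swap c j) ⊗ detℕ n (minor (λ r t → M r (swap c t)) j))
      ≈ - (sgn (swap c j) ⊗ (M 0 (swap c j) ⊗ detℕ n (minor M (swap c j))))

  detℕ-swap (suc n) c M cb = begin
    ∑ (suc n) (λ j → sgn j ⊗ (M 0 (swap c j) ⊗ detℕ n (minor (λ r t → M r (swap c t)) j)))
                                               ≈⟨ ∑-cong (suc n) (swapTerm n c M cb) ⟩
    ∑ (suc n) (λ j → - term (swap c j))        ≈⟨ ∑-neg (suc n) (λ j → term (swap c j)) ⟩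
    - ∑ (suc n) (λ j → term (swap c j))        ≈⟨ -‿cong (∑-swap (suc n) c term cb) ⟩
    - ∑ (suc n) term                           ∎
    where
    term : ℕ → Carrier
    term j = sgn j ⊗ (M 0 j ⊗ detℕ n (minor M j))

  swapTerm n c M cb j jb with ℕₚ.<-cmp j c
  ... | tri≈ _ P.refl _ rewrite swap-left j =
        trans (sgn-pred j _) (-‿cong (*-cong refl (*-cong refl
          (detℕ-cong≡ n _ _ (λ r t → P.cong (M (suc r)) (swap-skip-left j t))))))
  swapTerm n (suc c) M (s≤s cb) j jb | tri< (s≤s j≤c) _ _
    rewrite swap-other (suc c) j (λ e → ℕₚ.<-irrefl e (s≤s j≤c)) (λ e → ℕₚ.<-irrefl e (ℕₚ.m≤n⇒m≤1+n (s≤s j≤c))) =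
        trans (*-cong refl (*-cong refl (trans (detℕ-cong≡ n _ _ (λ r t → P.cong (M (suc r)) (swap-skip-before c j t j≤c)))
                                               (detℕ-swap n c (minor M j) cb))))
              (*-neg _ _ _)
  swapTerm n c M cb j jb | tri> _ _ c<j with j ≟ suc c
  ... | yes P.refl rewrite swap-right c =
        trans (sgn-suc c _) (-‿cong (*-cong refl (*-cong refl
          (detℕ-cong≡ n _ _ (λ r t → P.cong (M (suc r)) (swap-skip-right c t))))))
  ... | no ne with ℕₚ.≤∧≢⇒< c<j (λ e → ne (P.sym e))
  ...   | sc<j rewrite swap-other c j (λ e → ℕₚ.<-irrefl (P.sym e) c<j) ne =
        trans (*-cong refl (*-cong refl (trans (detℕ-cong≡ n _ _ (λ r t → P.cong (M (suc r)) (swap-skip-after c j t sc<j)))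
                                               (detℕ-swap n c (minor M j) (ℕₚ.<-≤-trans sc<j (ℕₚ.≤-pred jb))))))
              (*-neg _ _ _)

  ∑-cancellingPair : ∀ n c (f : ℕ → Carrier) → suc c < n → (∀ j → j < n → j ≢ c → j ≢ suc c → f j ≈ 0#) →
                     f c ⊕ f (suc c) ≈ 0# → ∑ n f ≈ 0#
  ∑-cancellingPair (suc (suc n)) zero f _ h hp =
    trans (sym (+-assoc _ _ _)) (trans (+-cong hp (∑-zero n (λ j jb → h (suc (suc j)) (s≤s (s≤s jb)) (λ ()) (λ ())))) (+-identityʳ _))
  ∑-cancellingPair (suc n) (suc c) f (s≤s cb) h hp =
    trans (+-cong (h 0 (s≤s z≤n) (λ ()) (λ ()))
                  (∑-cancellingPair n c (λ j → f (suc j)) cb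
                    (λ j jb ne₁ ne₂ → h (suc j) (s≤s jb) (λ e → ne₁ (ℕₚ.suc-injective e)) (λ e → ne₂ (ℕₚ.suc-injective e))) hp))
          (+-identityʳ _)

  -- A matrix with two equal adjacent columns has determinant zero: the
  -- expansion terms of these two columns cancel, all other minors again have
  -- two equal adjacent columns.
  detℕ-equalAdjacent : ∀ n c (M : Mat) → suc c < n → (∀ r → r < n → M r c ≈ M r (suc c)) → detℕ n M ≈ 0#
  equalAdjacentTerm : ∀ n c (M : Mat) → suc c < suc n → (∀ r → r < suc n → M r c ≈ M r (suc c)) →
    ∀ j → j < suc n → j ≢ c → j ≢ suc c → sgn j ⊗ (M 0 j ⊗ detℕ n (minor M j)) ≈ 0#

  detℕ-equalAdjacent (suc n) c M cb h = ∑-cancellingPair (suc n) c _ cb (equalAdjacentTerm n c M cb h) cancel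
    where
    sameMinor : detℕ n (minor M c) ≈ detℕ n (minor M (suc c))
    sameMinor = detℕ-cong n _ _ (λ r t rb _ → entry r t rb (t ≟ c))
      where
      entry : ∀ r t → r < n → Dec (t ≡ c) → M (suc r) (skip c t) ≈ M (suc r) (skip (suc c) t)
      entry r t rb (yes P.refl) rewrite skip-above t t ℕₚ.≤-refl | skip-below (suc t) t ℕₚ.≤-refl = sym (h (suc r) (s≤s rb))
      entry r t rb (no ne)      = reflexive (P.cong (M (suc r)) (skip-left≡skip-right c t ne))
    cancel : sgn c ⊗ (M 0 c ⊗ detℕ n (minor M c)) ⊕ sgn (suc c) ⊗ (M 0 (suc c) ⊗ detℕ n (minor M (suc c))) ≈ 0#
    cancel = trans (+-cong (*-cong refl (*-cong (h 0 (s≤s z≤n)) sameMinor)) (sgn-suc c _)) (-‿inverseʳ _)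

  equalAdjacentTerm n c M cb h j jb ne₁ ne₂ with ℕₚ.<-cmp j c
  ... | tri≈ _ e _ = ⊥-elim (ne₁ e)
  equalAdjacentTerm n (suc c) M (s≤s cb) h j jb ne₁ ne₂ | tri< (s≤s j≤c) _ _ =
    vanish (detℕ-equalAdjacent n c (minor M j) cb (λ r rb →
      P.subst₂ (λ a b → M (suc r) a ≈ M (suc r) b) (P.sym (skip-above j c j≤c)) (P.sym (skip-above j (suc c) (ℕₚ.m≤n⇒m≤1+n j≤c)))
        (h (suc r) (s≤s rb))))
  equalAdjacentTerm n c M cb h j jb ne₁ ne₂ | tri> _ _ c<j with ℕₚ.≤∧≢⇒< c<j (λ e → ne₂ (P.sym e))
  ... | sc<j = vanish (detℕ-equalAdjacent n c (minor M j) (ℕₚ.<-≤-trans sc<j (ℕₚ.≤-pred jb)) (λ r rb →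
      P.subst₂ (λ a b → M (suc r) a ≈ M (suc r) b) (P.sym (skip-below j c c<j)) (P.sym (skip-below j (suc c) sc<j))
        (h (suc r) (s≤s rb))))

  -- Equal columns i < j force determinant zero: move column j next to
  -- column i by adjacent swaps.
  detℕ-equalColumns : ∀ i j n (M : Mat) → i < j → j < n → (∀ r → r < n → M r i ≈ M r j) → detℕ n M ≈ 0#
  detℕ-equalColumns i (suc j) n M (s≤s i≤j) jb h =
    atDistance (j ∸ i) M (P.subst (λ x → suc x < n) (P.sym (ℕₚ.m∸n+n≡m i≤j)) jb)
      (λ r rb → P.subst (λ x → M r i ≈ M r (suc x)) (P.sym (ℕₚ.m∸n+n≡m i≤j)) (h r rb))
    where
    atDistance : ∀ d (M : Mat) → suc (d + i) < n → (∀ r → r < n → M r i ≈ M r (suc (d + i))) → detℕ n M ≈ 0#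
    atDistance zero    M b h = detℕ-equalAdjacent n i M b h
    atDistance (suc d) M b h =
      neg≈0 _ (trans (sym (detℕ-swap n c M b)) (atDistance d (λ r t → M r (swap c t)) (ℕₚ.<-trans (ℕₚ.n<1+n _) b) swapped))
      where
      c : ℕ
      c = suc (d + i)
      swapped : ∀ r → r < n → M r (swap c i) ≈ M r (swap c c)
      swapped r rb rewrite swap-left c
                         | swap-other c i (λ e → ℕₚ.<-irrefl e (s≤s (ℕₚ.m≤n+m i d)))
                                          (λ e → ℕₚ.<-irrefl e (ℕₚ.m≤n⇒m≤1+n (s≤s (ℕₚ.m≤n+m i d)))) = h r rb

  -- rotate m moves column m to position 0 and columns 0,…,m-1 one step right;
  -- it is a product of m adjacent transpositions.
  rotate : ℕ → ℕ → ℕ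
  rotate zero    t = t
  rotate (suc m) t = rotate m (swap m t)

  rotate-after : ∀ m t → m < t → rotate m t ≡ t
  rotate-after zero    t _ = P.refl
  rotate-after (suc m) t p
    rewrite swap-other m t (λ e → ℕₚ.<-irrefl (P.sym e) (ℕₚ.<-trans (ℕₚ.n<1+n m) p)) (λ e → ℕₚ.<-irrefl (P.sym e) p) =
    rotate-after m t (ℕₚ.<-trans (ℕₚ.n<1+n m) p)

  rotate-at : ∀ m → rotate m m ≡ 0
  rotate-at zero    = P.refl
  rotate-at (suc m) rewrite swap-right m = rotate-at m

  rotate-before : ∀ m t → t < m → rotate m t ≡ suc t
  rotate-before (suc m) t (s≤s p) with t ≟ m
  ... | yes P.refl rewrite swap-left t = rotate-after t (suc t) ℕₚ.≤-refl
  ... | no ne rewrite swap-other m t ne (λ e → ℕₚ.<-irrefl e (s≤s p)) = rotate-before m t (ℕₚ.≤∧≢⇒< p ne)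

  detℕ-rotate : ∀ m n (M : Mat) → m < n → detℕ n (λ r t → M r (rotate m t)) ≈ sgn m ⊗ detℕ n M
  detℕ-rotate zero    n M _ = sym (*-identityˡ _)
  detℕ-rotate (suc m) n M b =
    trans (detℕ-swap n m (λ r t → M r (rotate m t)) b)
          (trans (-‿cong (detℕ-rotate m n M (ℕₚ.<-trans (ℕₚ.n<1+n m) b))) (sym (sgn-suc m _)))

  detℕ-unitriangular : ∀ n (M : Mat) → (∀ r t → r < n → t < n → t < r → M r t ≈ 0#) → (∀ r → r < n → M r r ≈ 1#) →
                       detℕ n M ≈ 1#
  detℕ-unitriangular zero    M below diag = refl
  detℕ-unitriangular (suc n) M below diag =
    trans (+-cong firstTerm (∑-zero n (λ j jb → vanish (detℕ-zeroColumn n 0 (minor M (suc j)) (ℕₚ.<-≤-trans (s≤s z≤n) jb)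
                                                  (λ r rb → below (suc r) 0 (s≤s rb) (s≤s z≤n) (s≤s z≤n))))))
          (+-identityʳ _)
    where
    firstTerm : 1# ⊗ (M 0 0 ⊗ detℕ n (minor M 0)) ≈ 1#
    firstTerm = trans (*-identityˡ _) (trans (*-cong (diag 0 (s≤s z≤n))
      (detℕ-unitriangular n (minor M 0) (λ r t rb tb tr → below (suc r) (suc t) (s≤s rb) (s≤s tb) (s≤s tr))
                                        (λ r rb → diag (suc r) (s≤s rb)))) (*-identityˡ _))

module Compositions where

  firstParts : ℕ → ℕ → List ℕ
  firstParts K m = filterᵇ (λ ℓ → ℓ ≤ᵇ m) (map suc (upTo K))

  All-filterᵇ : ∀ {u p} {X : Set u} {Q : X → Set p} (b : X → Bool) xs →
                All (λ x → b x ≡ true → Q x) xs → All Q (filterᵇ b xs)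
  All-filterᵇ b []       []       = []
  All-filterᵇ b (x ∷ xs) (h ∷ hs) with b x
  ... | true  = h P.refl ∷ All-filterᵇ b xs hs
  ... | false = All-filterᵇ b xs hs

  firstParts-bounds : ∀ K m → All (λ ℓ → 1 ≤ ℓ × ℓ ≤ m) (firstParts K m)
  firstParts-bounds K m = All-filterᵇ (λ ℓ → ℓ ≤ᵇ m) (map suc (upTo K))
    (P.subst (All _) (P.sym (Listₚ.map-upTo suc K))
      (applyUpTo⁺₂ suc K (λ i e → s≤s z≤n , ℕₚ.≤ᵇ⇒≤ (suc i) m (P.subst T (P.sym e) _))))

  compsFuel-enough : ∀ K f f′ m → m ≤ f → m ≤ f′ → compsFuel K f m ≡ compsFuel K f′ m
  compsFuel-enough K zero    zero     zero    _       _        = P.refl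
  compsFuel-enough K zero    (suc f′) zero    _       _        = P.refl
  compsFuel-enough K (suc f) zero     zero    _       _        = P.refl
  compsFuel-enough K (suc f) (suc f′) zero    _       _        = P.refl
  compsFuel-enough K (suc f) (suc f′) (suc m) (s≤s p) (s≤s p′) =
    P.cong concat (Listₚ.map-cong-local (All.map
      (λ { {ℓ} (1≤ℓ , _) → P.cong (map (ℓ ∷_)) (compsFuel-enough K f f′ (suc m ∸ ℓ) (rest≤ ℓ 1≤ℓ p) (rest≤ ℓ 1≤ℓ p′)) })
      (firstParts-bounds K (suc m))))
    where
    rest≤ : ∀ ℓ → 1 ≤ ℓ → ∀ {g} → m ≤ g → suc m ∸ ℓ ≤ g
    rest≤ (suc ℓ) _ q = ℕₚ.≤-trans (ℕₚ.m∸n≤m m ℓ) q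

  IsComposition : ℕ → List ℕ → Set
  IsComposition m ls = (sum ls ≡ m) × All (1 ≤_) ls

  composition-cons : ∀ m ℓ ls → 1 ≤ ℓ → ℓ ≤ m → IsComposition (m ∸ ℓ) ls → IsComposition m (ℓ ∷ ls)
  composition-cons m ℓ ls 1≤ℓ ℓ≤m (e , pos) = P.trans (P.cong (λ x → ℓ + x) e) (ℕₚ.m+[n∸m]≡n ℓ≤m) , 1≤ℓ ∷ pos

  compsFuel-compositions : ∀ K f m → All (IsComposition m) (compsFuel K f m)
  compsFuel-compositions K zero    zero    = (P.refl , []) ∷ []
  compsFuel-compositions K zero    (suc m) = []
  compsFuel-compositions K (suc f) zero    = (P.refl , []) ∷ []
  compsFuel-compositions K (suc f) (suc m) =
    concat⁺ (map⁺ (All.map (λ { {ℓ} (1≤ℓ , ℓ≤m) →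
      map⁺ (All.map (composition-cons (suc m) ℓ _ 1≤ℓ ℓ≤m) (compsFuel-compositions K f (suc m ∸ ℓ))) })
      (firstParts-bounds K (suc m))))

  -- The layered permutation of a composition of X with first part ℓ+1 starts
  -- with the letter X-ℓ ≤ X, below every letter of a block placed before it.
  blocks-descend : ∀ X ℓ ls → IsComposition X (suc ℓ ∷ ls) → suc (X ∸ suc ℓ) ≤ X
  blocks-descend X ℓ ls (e , _) =
    P.subst (λ x → suc (x ∸ suc ℓ) ≤ x) e
      (P.subst (λ y → suc y ≤ suc ℓ + sum ls) (P.sym (ℕₚ.m+n∸m≡n (suc ℓ) (sum ls))) (s≤s (ℕₚ.m≤n+m _ ℓ)))

  <ᵇ-true : ∀ b a → b ≤ a → (b <ᵇ suc a) ≡ true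
  <ᵇ-true zero    a       _       = P.refl
  <ᵇ-true (suc b) (suc a) (s≤s p) = <ᵇ-true b a p

  <ᵇ-false : ∀ b a → ¬ (b ≤ a) → (b <ᵇ suc a) ≡ false
  <ᵇ-false zero    a       h = ⊥-elim (h z≤n)
  <ᵇ-false (suc b) zero    h = P.refl
  <ᵇ-false (suc b) (suc a) h = <ᵇ-false b a (λ p → h (s≤s p))

  suc<ᵇ-false : ∀ a → (suc a <ᵇ a) ≡ false
  suc<ᵇ-false zero    = P.refl
  suc<ᵇ-false (suc a) = suc<ᵇ-false a

  -- A block is increasing, so it has no descents ...
  maj-block : ∀ a ℓ i → majFrom i (block a ℓ) ≡ 0
  maj-block a zero          i = P.refl
  maj-block a (suc zero)    i = P.refl
  maj-block a (suc (suc ℓ)) i =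
    P.trans (P.cong (λ b → (if b then i else 0) + majFrom (suc i) (block (suc a) (suc ℓ))) (suc<ᵇ-false a))
            (maj-block (suc a) (suc ℓ) (suc i))

  maj-block++ : ∀ ℓ a i b w → b ≤ a → majFrom i (block a (suc ℓ) ++ b ∷ w) ≡ (i + ℓ) + majFrom (suc (i + ℓ)) (b ∷ w)
  maj-block++ zero    a i b w h rewrite <ᵇ-true b a h | ℕₚ.+-identityʳ i = P.refl
  maj-block++ (suc ℓ) a i b w h
    rewrite suc<ᵇ-false a | maj-block++ ℓ (suc a) (suc i) b w (ℕₚ.m≤n⇒m≤1+n h) | ℕₚ.+-suc i ℓ = P.refl

  -- The layered permutation of a composition with r parts has r-1 descents,
  -- so shifting all positions by d raises maj by d·(r-1).
  maj-offset : ∀ m ls i d → IsComposition m ls →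
               majFrom (i + d) (layeredFrom m ls) ≡ majFrom i (layeredFrom m ls) + d ℕ.* (length ls ∸ 1)
  maj-offset m []       i d _ = P.sym (ℕₚ.*-zeroʳ d)
  maj-offset m (ℓ ∷ []) i d _
    rewrite Listₚ.++-identityʳ (block (m ∸ ℓ) ℓ) | maj-block (m ∸ ℓ) ℓ (i + d) | maj-block (m ∸ ℓ) ℓ i | ℕₚ.*-zeroʳ d = P.refl
  maj-offset m (suc ℓ₀ ∷ zero ∷ ls)   i d (e , _ ∷ () ∷ _)
  maj-offset m (suc ℓ₀ ∷ suc ℓ₁ ∷ ls) i d (e , _ ∷ pos) = begin
    majFrom (i + d) (block (m ∸ suc ℓ₀) (suc ℓ₀) ++ rest)
      ≡⟨ maj-block++ ℓ₀ (m ∸ suc ℓ₀) (i + d) _ _ below ⟩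
    (i + d + ℓ₀) + majFrom (suc (i + d + ℓ₀)) rest
      ≡⟨ P.cong (λ x → (i + d + ℓ₀) + majFrom (suc x) rest) (regroup i d ℓ₀) ⟩
    (i + d + ℓ₀) + majFrom (suc (i + ℓ₀) + d) rest
      ≡⟨ P.cong (λ x → (i + d + ℓ₀) + x) (maj-offset (m ∸ suc ℓ₀) (suc ℓ₁ ∷ ls) (suc (i + ℓ₀)) d tail) ⟩
    (i + d + ℓ₀) + (majFrom (suc (i + ℓ₀)) rest + d ℕ.* length ls)
      ≡⟨ collect i d ℓ₀ (majFrom (suc (i + ℓ₀)) rest) (length ls) ⟩
    (i + ℓ₀ + majFrom (suc (i + ℓ₀)) rest) + d ℕ.* suc (length ls)
      ≡⟨ P.cong (_+ d ℕ.* suc (length ls)) (P.sym (maj-block++ ℓ₀ (m ∸ suc ℓ₀) i _ _ below)) ⟩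
    majFrom i (block (m ∸ suc ℓ₀) (suc ℓ₀) ++ rest) + d ℕ.* suc (length ls) ∎
    where
    open P.≡-Reasoning
    rest : List ℕ
    rest = layeredFrom (m ∸ suc ℓ₀) (suc ℓ₁ ∷ ls)
    tail : IsComposition (m ∸ suc ℓ₀) (suc ℓ₁ ∷ ls)
    tail = P.trans (P.sym (ℕₚ.m+n∸m≡n (suc ℓ₀) _)) (P.cong (_∸ suc ℓ₀) e) , pos
    below : suc (m ∸ suc ℓ₀ ∸ suc ℓ₁) ≤ m ∸ suc ℓ₀
    below = blocks-descend (m ∸ suc ℓ₀) ℓ₁ ls tail
    regroup : ∀ i d l → i + d + l ≡ i + l + d
    regroup = solve-∀
    collect : ∀ i d l M k → (i + d + l) + (M + d ℕ.* k) ≡ (i + l + M) + d ℕ.* suc k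
    collect = solve-∀

+-∸-absorb : ∀ a b A → a + b ≤ A → a + (A ∸ (a + b)) ≡ A ∸ b
+-∸-absorb a b A a+b≤A = begin
  a + (A ∸ (a + b))           ≡⟨ P.sym (ℕₚ.m+n∸m≡n b _) ⟩
  b + (a + (A ∸ (a + b))) ∸ b ≡⟨ P.cong (_∸ b) (P.sym (ℕₚ.+-assoc b a _)) ⟩
  (b + a) + (A ∸ (a + b)) ∸ b ≡⟨ P.cong (λ x → x + (A ∸ (a + b)) ∸ b) (ℕₚ.+-comm b a) ⟩
  (a + b) + (A ∸ (a + b)) ∸ b ≡⟨ P.cong (_∸ b) (ℕₚ.m+[n∸m]≡n a+b≤A) ⟩
  A ∸ b                       ∎
  where open P.≡-Reasoning

∸-suc-< : ∀ a i → i < a → a ∸ suc i < a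
∸-suc-< (suc a) i _ = s≤s (ℕₚ.m∸n≤m a i)

module Signs {a ℓ : Level} (R : CommutativeRing a ℓ) where
  open CommutativeRing R using (_≈_; refl; trans; reflexive; -‿cong; ring; +-group)
  open import Algebra.Properties.Ring ring using (-1*x≈-x)
  open import Algebra.Properties.Group +-group using (⁻¹-involutive)

  signPow-+2 : ∀ e → signPow R (suc (suc e)) ≈ signPow R e
  signPow-+2 e = trans (-1*x≈-x _) (trans (-‿cong (-1*x≈-x _)) (⁻¹-involutive _))

  signPow-even : ∀ b y → signPow R (b + (y + y)) ≈ signPow R b
  signPow-even b zero    = reflexive (P.cong (signPow R) (ℕₚ.+-identityʳ b))
  signPow-even b (suc y) = trans (reflexive (P.cong (signPow R) (b+2+2y b y))) (trans (signPow-+2 (b + (y + y))) (signPow-even b y))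
    where
    b+2+2y : ∀ b y → b + (suc y + suc y) ≡ suc (suc (b + (y + y)))
    b+2+2y = solve-∀

parity : ∀ k → Σ ℕ (λ m → k ≡ m + m) ⊎ Σ ℕ (λ m → k ≡ suc (m + m))
parity zero = inj₁ (0 , P.refl)
parity (suc k) with parity k
... | inj₁ (m , k≡2m)   = inj₂ (m , P.cong suc k≡2m)
... | inj₂ (m , k≡2m+1) = inj₁ (suc m , P.trans (P.cong suc k≡2m+1) (P.cong suc (P.sym (ℕₚ.+-suc m m))))

module Layered {u v : Level} (R : CommutativeRing u v) (q : CommutativeRing.Carrier R) where
  open CommutativeRing R hiding (zero) renaming (_+_ to _⊕_; _*_ to _⊗_)
  open Sums R
  open Determinants R
  open Compositions
  open import Algebra.Solver.Ring.NaturalCoefficients.Default commutativeSemiring using (solve; _:+_; _:*_; _:=_)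
  open import Algebra.Properties.CommutativeSemigroup *-commutativeSemigroup using (x∙yz≈y∙xz; interchange)
  open SetoidReasoning setoid

  Fq : ℕ → ℕ → (ℕ → Carrier) → Carrier
  Fq K n z = F R K n z q

  infixr 8 _^_
  _^_ : Carrier → ℕ → Carrier
  _^_ = pow R

  ^-+ : ∀ x m n → x ^ (m + n) ≈ x ^ m ⊗ x ^ n
  ^-+ x zero    n = sym (*-identityˡ _)
  ^-+ x (suc m) n = trans (*-cong refl (^-+ x m n)) (sym (*-assoc _ _ _))

  infixl 5 _↑_
  _↑_ : (ℕ → Carrier) → ℕ → (ℕ → Carrier)
  z ↑ m = shift R z q m

  ↑-↑ : ∀ z m n i → (z ↑ m ↑ n) i ≈ (z ↑ m + n) i
  ↑-↑ z m n i = trans (*-assoc _ _ _) (*-cong refl (sym (^-+ q m n)))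

  prodZ-↑ : ∀ z m ls → prodZ R (z ↑ m) ls ≈ prodZ R z ls ⊗ q ^ (m ℕ.* length ls)
  prodZ-↑ z m [] = trans (sym (*-identityˡ _)) (*-cong refl (reflexive (P.cong (q ^_) (P.sym (ℕₚ.*-zeroʳ m)))))
  prodZ-↑ z m (x ∷ ls) = begin
    (z x ⊗ q ^ m) ⊗ prodZ R (z ↑ m) ls                   ≈⟨ *-cong refl (prodZ-↑ z m ls) ⟩
    (z x ⊗ q ^ m) ⊗ (prodZ R z ls ⊗ q ^ (m ℕ.* length ls)) ≈⟨ interchange _ _ _ _ ⟩
    (z x ⊗ prodZ R z ls) ⊗ (q ^ m ⊗ q ^ (m ℕ.* length ls)) ≈⟨ *-cong refl (sym (^-+ q m _)) ⟩
    (z x ⊗ prodZ R z ls) ⊗ q ^ (m + m ℕ.* length ls)       ≡⟨ P.cong (λ e → (z x ⊗ prodZ R z ls) ⊗ q ^ e) (P.sym (ℕₚ.*-suc m (length ls))) ⟩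
    (z x ⊗ prodZ R z ls) ⊗ q ^ (m ℕ.* suc (length ls))     ∎

  weight : (ℕ → Carrier) → ℕ → List ℕ → Carrier
  weight z n ls = prodZ R z ls ⊗ q ^ maj (layered n ls)

  -- Peeling the first layer ℓ: the descents of the remaining layered
  -- permutation move ℓ places right, which is exactly the substitution z ↑ ℓ.
  weight-cons : ∀ z n ℓ ls → 1 ≤ ℓ → IsComposition (n ∸ ℓ) ls → weight z n (ℓ ∷ ls) ≈ z ℓ ⊗ weight (z ↑ ℓ) (n ∸ ℓ) ls
  weight-cons z n ℓ [] _ _ = begin
    (z ℓ ⊗ 1#) ⊗ q ^ majFrom 1 (block (n ∸ ℓ) ℓ ++ [])
      ≡⟨ P.cong (λ e → (z ℓ ⊗ 1#) ⊗ q ^ e) (P.trans (P.cong (majFrom 1) (Listₚ.++-identityʳ (block (n ∸ ℓ) ℓ))) (maj-block (n ∸ ℓ) ℓ 1)) ⟩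
    (z ℓ ⊗ 1#) ⊗ 1#  ≈⟨ trans (*-identityʳ _) (*-cong refl (sym (*-identityˡ _))) ⟩
    z ℓ ⊗ (1# ⊗ 1#)  ∎
  weight-cons z n ℓ (zero ∷ ls) _ (_ , () ∷ _)
  weight-cons z n (suc ℓ₀) (suc ℓ₁ ∷ ls) _ comp = begin
    (z ℓ ⊗ Π) ⊗ q ^ majFrom 1 (block (n ∸ ℓ) ℓ ++ rest)
      ≡⟨ P.cong (λ e → (z ℓ ⊗ Π) ⊗ q ^ e) majEq ⟩
    (z ℓ ⊗ Π) ⊗ q ^ (ℓ + (M + ℓ ℕ.* length ls))
      ≈⟨ *-cong refl (trans (^-+ q ℓ _) (*-cong refl (^-+ q M _))) ⟩
    (z ℓ ⊗ Π) ⊗ (q ^ ℓ ⊗ (q ^ M ⊗ q ^ (ℓ ℕ.* length ls)))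
      ≈⟨ regroup _ _ _ _ _ ⟩
    z ℓ ⊗ ((Π ⊗ (q ^ ℓ ⊗ q ^ (ℓ ℕ.* length ls))) ⊗ q ^ M)
      ≈⟨ *-cong refl (*-cong (*-cong refl (sym (^-+ q ℓ _))) refl) ⟩
    z ℓ ⊗ ((Π ⊗ q ^ (ℓ + ℓ ℕ.* length ls)) ⊗ q ^ M)
      ≡⟨ P.cong (λ e → z ℓ ⊗ ((Π ⊗ q ^ e) ⊗ q ^ M)) (P.sym (ℕₚ.*-suc ℓ (length ls))) ⟩
    z ℓ ⊗ ((Π ⊗ q ^ (ℓ ℕ.* length (suc ℓ₁ ∷ ls))) ⊗ q ^ M)
      ≈⟨ *-cong refl (*-cong (sym (prodZ-↑ z ℓ (suc ℓ₁ ∷ ls))) refl) ⟩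
    z ℓ ⊗ weight (z ↑ ℓ) (n ∸ ℓ) (suc ℓ₁ ∷ ls) ∎
    where
    ℓ : ℕ
    ℓ = suc ℓ₀
    rest : List ℕ
    rest = layeredFrom (n ∸ ℓ) (suc ℓ₁ ∷ ls)
    M : ℕ
    M = majFrom 1 rest
    Π : Carrier
    Π = prodZ R z (suc ℓ₁ ∷ ls)
    majEq : majFrom 1 (block (n ∸ ℓ) ℓ ++ rest) ≡ ℓ + (M + ℓ ℕ.* length ls)
    majEq = P.trans (maj-block++ ℓ₀ (n ∸ ℓ) 1 _ _ (blocks-descend (n ∸ ℓ) ℓ₁ ls comp))
                    (P.cong (λ x → ℓ + x) (maj-offset (n ∸ ℓ) (suc ℓ₁ ∷ ls) 1 ℓ comp))
    regroup : ∀ x₁ x₂ x₃ x₄ x₅ → (x₁ ⊗ x₂) ⊗ (x₃ ⊗ (x₄ ⊗ x₅)) ≈ x₁ ⊗ ((x₂ ⊗ (x₃ ⊗ x₅)) ⊗ x₄)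
    regroup = solve 5 (λ x₁ x₂ x₃ x₄ x₅ → (x₁ :* x₂) :* (x₃ :* (x₄ :* x₅)) := x₁ :* ((x₂ :* (x₃ :* x₅)) :* x₄)) refl

  prodZ-cong : ∀ (z z′ : ℕ → Carrier) ls → (∀ i → z i ≈ z′ i) → prodZ R z ls ≈ prodZ R z′ ls
  prodZ-cong z z′ []       h = refl
  prodZ-cong z z′ (x ∷ ls) h = *-cong (h x) (prodZ-cong z z′ ls h)

  F-cong : ∀ K n (z z′ : ℕ → Carrier) → (∀ i → z i ≈ z′ i) → Fq K n z ≈ Fq K n z′
  F-cong K n z z′ h = sumList-cong _ _ (comps K n) (All.tabulate (λ {ls} _ → *-cong (prodZ-cong z z′ ls h) refl))

  F-zero : ∀ K z → Fq K 0 z ≈ 1#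
  F-zero K z = trans (+-identityʳ _) (*-identityˡ _)

  Fdiff : ℕ → ℕ → ℕ → (ℕ → Carrier) → Carrier
  Fdiff K A       zero    z = Fq K A z
  Fdiff K zero    (suc B) z = 0#
  Fdiff K (suc A) (suc B) z = Fdiff K A B z

  Fdiff-≤ : ∀ K A B z → B ≤ A → Fdiff K A B z ≡ Fq K (A ∸ B) z
  Fdiff-≤ K A       zero    z _       = P.refl
  Fdiff-≤ K (suc A) (suc B) z (s≤s p) = Fdiff-≤ K A B z p

  Fdiff-> : ∀ K A B z → A < B → Fdiff K A B z ≡ 0#
  Fdiff-> K zero    (suc B) z _       = P.refl
  Fdiff-> K (suc A) (suc B) z (s≤s p) = Fdiff-> K A B z p

  Fdiff-+ : ∀ K c A B z → Fdiff K (c + A) (c + B) z ≡ Fdiff K A B z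
  Fdiff-+ K zero    A B z = P.refl
  Fdiff-+ K (suc c) A B z = Fdiff-+ K c A B z

  Fdiff-cong : ∀ K A B (z z′ : ℕ → Carrier) → (∀ i → z i ≈ z′ i) → Fdiff K A B z ≈ Fdiff K A B z′
  Fdiff-cong K A       zero    z z′ h = F-cong K A z z′ h
  Fdiff-cong K zero    (suc B) z z′ h = refl
  Fdiff-cong K (suc A) (suc B) z z′ h = Fdiff-cong K A B z z′ h

  firstLayerClass : ∀ K n i z → i ≤ n →
    sumList R (map (weight z (suc n)) (map (suc i ∷_) (compsFuel K n (n ∸ i)))) ≈ z (suc i) ⊗ Fq K (n ∸ i) (z ↑ suc i)
  firstLayerClass K n i z i≤n = begin
    sumList R (map (weight z (suc n)) (map (suc i ∷_) (compsFuel K n (n ∸ i))))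
      ≡⟨ P.cong (sumList R) (P.sym (Listₚ.map-∘ (compsFuel K n (n ∸ i)))) ⟩
    sumList R (map (λ ls → weight z (suc n) (suc i ∷ ls)) (compsFuel K n (n ∸ i)))
      ≡⟨ P.cong (λ l → sumList R (map (λ ls → weight z (suc n) (suc i ∷ ls)) l))
                (compsFuel-enough K n (n ∸ i) (n ∸ i) (ℕₚ.m∸n≤m n i) ℕₚ.≤-refl) ⟩
    sumList R (map (λ ls → weight z (suc n) (suc i ∷ ls)) (comps K (n ∸ i)))
      ≈⟨ sumList-cong _ _ (comps K (n ∸ i)) (All.map (weight-cons z (suc n) (suc i) _ (s≤s z≤n))
                                                     (compsFuel-compositions K (n ∸ i) (n ∸ i))) ⟩
    sumList R (map (λ ls → z (suc i) ⊗ weight (z ↑ suc i) (n ∸ i) ls) (comps K (n ∸ i)))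
      ≈⟨ sumList-*ˡ (z (suc i)) _ (comps K (n ∸ i)) ⟩
    z (suc i) ⊗ Fq K (n ∸ i) (z ↑ suc i) ∎

  F-firstLayer : ∀ K n z → Fq K (suc n) z ≈ ∑ K (λ i → z (suc i) ⊗ Fdiff K (suc n) (suc i) (z ↑ suc i))
  F-firstLayer K n z = begin
    sumList R (map (weight z (suc n)) (concatMap class (firstParts K (suc n))))
      ≈⟨ sumList-concatMap (weight z (suc n)) class (firstParts K (suc n)) ⟩
    sumList R (map classSum (firstParts K (suc n)))
      ≈⟨ sumList-filterᵇ (λ ℓ → ℓ ≤ᵇ suc n) classSum (map suc (upTo K)) ⟩
    sumList R (map (λ ℓ → if ℓ ≤ᵇ suc n then classSum ℓ else 0#) (map suc (upTo K)))
      ≡⟨ P.cong (sumList R) (P.sym (Listₚ.map-∘ (upTo K))) ⟩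
    sumList R (map (λ i → if suc i ≤ᵇ suc n then classSum (suc i) else 0#) (upTo K))
      ≈⟨ sumList-upTo K _ ⟩
    ∑ K (λ i → if suc i ≤ᵇ suc n then classSum (suc i) else 0#)
      ≈⟨ ∑-cong′ K (λ i → term i (i ≤? n)) ⟩
    ∑ K (λ i → z (suc i) ⊗ Fdiff K (suc n) (suc i) (z ↑ suc i)) ∎
    where
    class : ℕ → List (List ℕ)
    class ℓ = map (ℓ ∷_) (compsFuel K n (suc n ∸ ℓ))
    classSum : ℕ → Carrier
    classSum ℓ = sumList R (map (weight z (suc n)) (class ℓ))
    term : ∀ i → Dec (i ≤ n) → (if i <ᵇ suc n then classSum (suc i) else 0#) ≈ z (suc i) ⊗ Fdiff K n i (z ↑ suc i)
    term i (no i≰n) = begin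
      (if i <ᵇ suc n then classSum (suc i) else 0#) ≡⟨ P.cong (λ b → if b then classSum (suc i) else 0#) (<ᵇ-false i n i≰n) ⟩
      0#                                             ≈⟨ sym (zeroʳ _) ⟩
      z (suc i) ⊗ 0#                                 ≡⟨ P.cong (z (suc i) ⊗_) (P.sym (Fdiff-> K n i _ (ℕₚ.≰⇒> i≰n))) ⟩
      z (suc i) ⊗ Fdiff K n i (z ↑ suc i)            ∎
    term i (yes i≤n) = begin
      (if i <ᵇ suc n then classSum (suc i) else 0#) ≡⟨ P.cong (λ b → if b then classSum (suc i) else 0#) (<ᵇ-true i n i≤n) ⟩
      classSum (suc i)                               ≈⟨ firstLayerClass K n i z i≤n ⟩
      z (suc i) ⊗ Fq K (n ∸ i) (z ↑ suc i)           ≡⟨ P.cong (z (suc i) ⊗_) (P.sym (Fdiff-≤ K n i _ i≤n)) ⟩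
      z (suc i) ⊗ Fdiff K n i (z ↑ suc i)            ∎

  δ : ℕ → ℕ → Carrier
  δ zero    zero    = 1#
  δ zero    (suc B) = 0#
  δ (suc A) zero    = 0#
  δ (suc A) (suc B) = δ A B

  δ-≢ : ∀ A B → A ≢ B → δ A B ≈ 0#
  δ-≢ zero    zero    h = ⊥-elim (h P.refl)
  δ-≢ zero    (suc B) h = refl
  δ-≢ (suc A) zero    h = refl
  δ-≢ (suc A) (suc B) h = δ-≢ A B (λ e → h (P.cong suc e))

  δ-refl : ∀ A → δ A A ≈ 1#
  δ-refl zero    = refl
  δ-refl (suc A) = δ-refl A

  q^-δ : ∀ A B → q ^ (A ∸ B) ⊗ δ A B ≈ δ A B
  q^-δ zero    zero    = *-identityˡ _
  q^-δ zero    (suc B) = zeroʳ _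
  q^-δ (suc A) zero    = zeroʳ _
  q^-δ (suc A) (suc B) = q^-δ A B

  Fdiff-firstLayer : ∀ K A B z → Fdiff K A B z ≈ δ A B ⊕ ∑ K (λ i → z (suc i) ⊗ Fdiff K A (B + suc i) (z ↑ suc i))
  Fdiff-firstLayer K zero    zero    z = trans (F-zero K z) (sym (trans (+-cong refl (∑-zero K (λ i _ → zeroʳ _))) (+-identityʳ _)))
  Fdiff-firstLayer K (suc A) zero    z = trans (F-firstLayer K A z) (sym (+-identityˡ _))
  Fdiff-firstLayer K zero    (suc B) z = sym (trans (+-cong refl (∑-zero K (λ i _ → zeroʳ _))) (+-identityʳ _))
  Fdiff-firstLayer K (suc A) (suc B) z = Fdiff-firstLayer K A B z

  -- q^a q^{A-(a+b)} F_{A-(a+b)} = q^{A-b} F_{A-(a+b)}: both sides vanish when A < a+b.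
  q^-absorb : ∀ K A a b w → q ^ a ⊗ (q ^ (A ∸ (a + b)) ⊗ Fdiff K A (a + b) w) ≈ q ^ (A ∸ b) ⊗ Fdiff K A (a + b) w
  q^-absorb K A a b w with (a + b) ≤? A
  ... | no a+b≰A rewrite Fdiff-> K A (a + b) w (ℕₚ.≰⇒> a+b≰A) = trans (*-cong refl (zeroʳ _)) (trans (zeroʳ _) (sym (zeroʳ _)))
  ... | yes a+b≤A = trans (sym (*-assoc _ _ _)) (*-cong (trans (sym (^-+ q a _)) (reflexive (P.cong (q ^_) (+-∸-absorb a b A a+b≤A)))) refl)

  -- Last-layer recursion:  F_{n+1}(z) = Σ_{ℓ=1}^{K} z_ℓ q^{n+1-ℓ} F_{n+1-ℓ}(z),
  -- since a last layer of length ℓ creates a descent at position n+1-ℓ.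
  -- It is proved together with its difference form by induction, peeling
  -- first layers: after the first layer the remaining word has its last layer
  -- peeled by induction, and the two peelings are then exchanged.
  F-lastLayer : ∀ K n z → Fq K (suc n) z ≈ ∑ K (λ j → z (suc j) ⊗ (q ^ (n ∸ j) ⊗ Fdiff K n j z))
  Fdiff-lastLayer : ∀ K A B z → Fdiff K A B z ≈ δ A B ⊕ ∑ K (λ i → z (suc i) ⊗ (q ^ (A ∸ (B + suc i)) ⊗ Fdiff K A (B + suc i) z))

  F-lastLayer K n z = begin
    Fq K (suc n) z
      ≈⟨ F-firstLayer K n z ⟩
    ∑ K (λ i → z (suc i) ⊗ Fdiff K n i (z ↑ suc i))
      ≈⟨ ∑-cong′ K (λ i → *-cong refl (Fdiff-lastLayer K n i (z ↑ suc i))) ⟩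
    ∑ K (λ i → z (suc i) ⊗ (δ n i ⊕ ∑ K (inner i)))
      ≈⟨ ∑-cong′ K (λ i → trans (distribˡ _ _ _) (+-cong refl (sym (∑-*ˡ K _ _)))) ⟩
    ∑ K (λ i → z (suc i) ⊗ δ n i ⊕ ∑ K (λ j → z (suc i) ⊗ inner i j))
      ≈⟨ ∑-+ K _ _ ⟩
    ∑ K (λ i → z (suc i) ⊗ δ n i) ⊕ ∑ K (λ i → ∑ K (λ j → z (suc i) ⊗ inner i j))
      ≈⟨ +-cong (∑-cong′ K (λ i → *-cong refl (sym (q^-δ n i))))
                (trans (∑-comm K K _) (∑-cong′ K (λ j → ∑-cong′ K (λ i → exchange i j)))) ⟩
    ∑ K (λ j → z (suc j) ⊗ (q ^ (n ∸ j) ⊗ δ n j)) ⊕ ∑ K (λ j → ∑ K (λ i → z (suc j) ⊗ (q ^ (n ∸ j) ⊗ first j i)))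
      ≈⟨ sym (trans (∑-cong′ K (λ j → regroup j)) (∑-+ K _ _)) ⟩
    ∑ K (λ j → z (suc j) ⊗ (q ^ (n ∸ j) ⊗ Fdiff K n j z)) ∎
    where
    -- a last layer of length j+1 after a first layer of length i+1
    inner : ℕ → ℕ → Carrier
    inner i j = (z ↑ suc i) (suc j) ⊗ (q ^ (n ∸ (i + suc j)) ⊗ Fdiff K n (i + suc j) (z ↑ suc i))
    -- a first layer of length i+1 before a last layer of length j+1
    first : ℕ → ℕ → Carrier
    first j i = z (suc i) ⊗ Fdiff K n (j + suc i) (z ↑ suc i)
    indexSwap : ∀ i j → i + suc j ≡ j + suc i
    indexSwap i j = P.trans (ℕₚ.+-suc i j) (P.trans (P.cong suc (ℕₚ.+-comm i j)) (P.sym (ℕₚ.+-suc j i)))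
    powers : ∀ i j → q ^ suc i ⊗ (q ^ (n ∸ (i + suc j)) ⊗ Fdiff K n (i + suc j) (z ↑ suc i))
                     ≈ q ^ (n ∸ j) ⊗ Fdiff K n (j + suc i) (z ↑ suc i)
    powers i j = P.subst (λ e → q ^ suc i ⊗ (q ^ (n ∸ e) ⊗ Fdiff K n e (z ↑ suc i)) ≈ q ^ (n ∸ j) ⊗ Fdiff K n (j + suc i) (z ↑ suc i))
                   (P.sym (P.trans (indexSwap i j) (ℕₚ.+-comm j (suc i))))
                   (trans (q^-absorb K n (suc i) j (z ↑ suc i))
                          (reflexive (P.cong (λ e → q ^ (n ∸ j) ⊗ Fdiff K n e (z ↑ suc i)) (ℕₚ.+-comm (suc i) j))))
    exchange : ∀ i j → z (suc i) ⊗ inner i j ≈ z (suc j) ⊗ (q ^ (n ∸ j) ⊗ first j i)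
    exchange i j = trans (shuffle₁ _ _ _ _) (trans (*-cong refl (*-cong refl (powers i j))) (shuffle₂ _ _ _ _))
      where
      shuffle₁ : ∀ a b c d → a ⊗ ((b ⊗ c) ⊗ d) ≈ b ⊗ (a ⊗ (c ⊗ d))
      shuffle₁ = solve 4 (λ a b c d → a :* ((b :* c) :* d) := b :* (a :* (c :* d))) refl
      shuffle₂ : ∀ a b c d → b ⊗ (a ⊗ (c ⊗ d)) ≈ b ⊗ (c ⊗ (a ⊗ d))
      shuffle₂ = solve 4 (λ a b c d → b :* (a :* (c :* d)) := b :* (c :* (a :* d))) refl
    regroup : ∀ j → z (suc j) ⊗ (q ^ (n ∸ j) ⊗ Fdiff K n j z)
                    ≈ z (suc j) ⊗ (q ^ (n ∸ j) ⊗ δ n j) ⊕ ∑ K (λ i → z (suc j) ⊗ (q ^ (n ∸ j) ⊗ first j i))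
    regroup j = trans (*-cong refl (*-cong refl (Fdiff-firstLayer K n j z)))
                  (trans (distrib₂ _ _ _ _) (+-cong refl (trans (*-cong refl (sym (∑-*ˡ K _ _))) (sym (∑-*ˡ K _ _)))))
      where
      distrib₂ : ∀ a b c d → a ⊗ (b ⊗ (c ⊕ d)) ≈ a ⊗ (b ⊗ c) ⊕ a ⊗ (b ⊗ d)
      distrib₂ = solve 4 (λ a b c d → a :* (b :* (c :+ d)) := a :* (b :* c) :+ a :* (b :* d)) refl

  Fdiff-lastLayer K zero    zero    z =
    trans (F-zero K z) (sym (trans (+-cong refl (∑-zero K (λ i _ → trans (*-cong refl (zeroʳ _)) (zeroʳ _)))) (+-identityʳ _)))
  Fdiff-lastLayer K (suc A) zero    z = trans (F-lastLayer K A z) (sym (+-identityˡ _))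
  Fdiff-lastLayer K zero    (suc B) z =
    sym (trans (+-cong refl (∑-zero K (λ i _ → trans (*-cong refl (zeroʳ _)) (zeroʳ _)))) (+-identityʳ _))
  Fdiff-lastLayer K (suc A) (suc B) z = Fdiff-lastLayer K A B z

  suc-C2 : ∀ N → suc N C 2 ≡ N + N C 2
  suc-C2 N = P.sym (P.trans (P.cong (_+ N C 2) (P.sym (nC1≡n N))) (nCk+nC[k+1]≡[n+1]C[k+1] N 1))

  module Hankel (K′ : ℕ) (z : ℕ → Carrier) where
    K : ℕ
    K = suc K′

    A : ℕ → Mat
    A N r t = Fdiff K (N + t) r (z ↑ r)

    -- A_0 is upper unitriangular: F_{t-r} vanishes for t < r and F_0 = 1.
    det-A₀ : detℕ K (A 0) ≈ 1#
    det-A₀ = detℕ-unitriangular K (A 0) (λ r t _ _ t<r → reflexive (Fdiff-> K t r (z ↑ r) t<r))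
      (λ r _ → trans (reflexive (P.trans (Fdiff-≤ K r r (z ↑ r) ℕₚ.≤-refl) (P.cong (λ x → Fq K x (z ↑ r)) (ℕₚ.n∸n≡0 r))))
                     (F-zero K (z ↑ r)))

    -- coefficients of the last-layer recursion for F_{N+K}
    coeff : ℕ → ℕ → Carrier
    coeff N ℓ = z ℓ ⊗ q ^ ((suc N + K′) ∸ ℓ)

    A-suc : ∀ N r t → A (suc N) r t ≡ A N r (suc t)
    A-suc N r t = P.cong (λ x → Fdiff K x r (z ↑ r)) (P.sym (ℕₚ.+-suc N t))

    lastColumn : ∀ N r → r < K →
      A (suc N) r K′ ≈ ∑ K′ (λ i → coeff N (suc i) ⊗ A (suc N) r (K′ ∸ suc i)) ⊕ coeff N K ⊗ A N r 0
    lastColumn N r r<K = begin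
      Fdiff K M r w
        ≈⟨ Fdiff-lastLayer K M r w ⟩
      δ M r ⊕ ∑ K (λ i → w (suc i) ⊗ (q ^ (M ∸ (r + suc i)) ⊗ Fdiff K M (r + suc i) w))
        ≈⟨ trans (+-cong (δ-≢ M r M≢r) refl) (+-identityˡ _) ⟩
      ∑ K (λ i → w (suc i) ⊗ (q ^ (M ∸ (r + suc i)) ⊗ Fdiff K M (r + suc i) w))
        ≈⟨ ∑-cong′ K absorb ⟩
      ∑ K (λ i → coeff N (suc i) ⊗ Fdiff K M (r + suc i) w)
        ≈⟨ ∑-last K′ _ ⟩
      ∑ K′ (λ i → coeff N (suc i) ⊗ Fdiff K M (r + suc i) w) ⊕ coeff N K ⊗ Fdiff K M (r + K) w
        ≈⟨ +-cong (∑-cong K′ (λ i i<K′ → *-cong refl (reflexive (middle i i<K′)))) (*-cong refl (reflexive last)) ⟩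
      ∑ K′ (λ i → coeff N (suc i) ⊗ A (suc N) r (K′ ∸ suc i)) ⊕ coeff N K ⊗ A N r 0 ∎
      where
      M : ℕ
      M = suc N + K′
      w : ℕ → Carrier
      w = z ↑ r
      M≢r : M ≢ r
      M≢r e = ℕₚ.<-irrefl (P.sym e) (ℕₚ.<-≤-trans r<K (s≤s (ℕₚ.m≤n+m K′ N)))
      absorb : ∀ i → w (suc i) ⊗ (q ^ (M ∸ (r + suc i)) ⊗ Fdiff K M (r + suc i) w) ≈ coeff N (suc i) ⊗ Fdiff K M (r + suc i) w
      absorb i = trans (*-assoc _ _ _) (trans (*-cong refl (q^-absorb K M r (suc i) w)) (sym (*-assoc _ _ _)))
      middle : ∀ i → i < K′ → Fdiff K M (r + suc i) w ≡ A (suc N) r (K′ ∸ suc i)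
      middle i i<K′ = P.trans (P.cong₂ (λ x y → Fdiff K x y w) M≡ (ℕₚ.+-comm r (suc i))) (Fdiff-+ K (suc i) _ r w)
        where
        M≡ : M ≡ suc i + (suc N + (K′ ∸ suc i))
        M≡ = P.trans (P.cong (λ x → suc N + x) (P.sym (ℕₚ.m+[n∸m]≡n i<K′)))
                     (P.trans (P.sym (ℕₚ.+-assoc (suc N) (suc i) _))
                              (P.trans (P.cong (_+ (K′ ∸ suc i)) (ℕₚ.+-comm (suc N) (suc i))) (ℕₚ.+-assoc (suc i) (suc N) _)))
      last : Fdiff K M (r + K) w ≡ A N r 0
      last = P.trans (P.cong₂ (λ x y → Fdiff K x y w) M≡ (ℕₚ.+-comm r K)) (Fdiff-+ K K (N + 0) r w)
        where
        M≡ : M ≡ K + (N + 0)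
        M≡ = P.trans (P.cong suc (ℕₚ.+-comm N K′)) (P.cong (λ x → K + x) (P.sym (ℕₚ.+-identityʳ N)))

    -- Replacing the last column of A_{N+1} by a combination of its other
    -- columns gives determinant zero (each summand has two equal columns).
    det-otherColumns : ∀ N → detℕ K (setCol (A (suc N)) K′ (λ r → ∑ K′ (λ i → coeff N (suc i) ⊗ A (suc N) r (K′ ∸ suc i)))) ≈ 0#
    det-otherColumns N =
      trans (detℕ-linearSum K′ K K′ A′ (λ i → coeff N (suc i)) col ℕₚ.≤-refl (λ r _ → reflexive (setCol-at A₁ K′ U r)))
            (∑-zero K′ (λ i i<K′ → trans (*-cong refl (repeated i i<K′)) (zeroʳ _)))
      where
      A₁ : Mat
      A₁ = A (suc N)
      col : ℕ → ℕ → Carrier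
      col i r = A₁ r (K′ ∸ suc i)
      U : ℕ → Carrier
      U r = ∑ K′ (λ i → coeff N (suc i) ⊗ col i r)
      A′ : Mat
      A′ = setCol A₁ K′ U
      repeated : ∀ i → i < K′ → detℕ K (setCol A′ K′ (col i)) ≈ 0#
      repeated i i<K′ = trans (detℕ-cong≡ K _ _ (setCol-setCol A₁ K′ U (col i)))
        (detℕ-equalColumns (K′ ∸ suc i) K′ K (setCol A₁ K′ (col i)) (∸-suc-< K′ i i<K′) ℕₚ.≤-refl
          (λ r _ → reflexive (P.trans (setCol-off A₁ K′ (col i) r (K′ ∸ suc i) (λ e → ℕₚ.<-irrefl e (∸-suc-< K′ i i<K′)))
                                      (P.sym (setCol-at A₁ K′ (col i) r)))))

    -- A_{N+1} with its last column replaced by the first column of A_N is A_N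
    -- with its columns rotated.
    det-rotatedColumns : ∀ N → detℕ K (setCol (A (suc N)) K′ (λ r → A N r 0)) ≈ sgn K′ ⊗ detℕ K (A N)
    det-rotatedColumns N = trans (detℕ-cong K _ _ (λ r t _ t<K → entry r t t<K (t ≟ K′))) (detℕ-rotate K′ K (A N) ℕₚ.≤-refl)
      where
      entry : ∀ r t → t < K → Dec (t ≡ K′) → setCol (A (suc N)) K′ (λ r → A N r 0) r t ≈ A N r (rotate K′ t)
      entry r t _ (yes P.refl) =
        reflexive (P.trans (setCol-at (A (suc N)) t (λ r → A N r 0) r) (P.cong (A N r) (P.sym (rotate-at t))))
      entry r t t<K (no t≢K′) =
        reflexive (P.trans (setCol-off (A (suc N)) K′ (λ r → A N r 0) r t t≢K′)
                           (P.trans (A-suc N r t) (P.cong (A N r) (P.sym (rotate-before K′ t (ℕₚ.≤∧≢⇒< (ℕₚ.≤-pred t<K) t≢K′))))))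

    det-A-suc : ∀ N → detℕ K (A (suc N)) ≈ sgn K′ ⊗ ((z K ⊗ q ^ N) ⊗ detℕ K (A N))
    det-A-suc N = begin
      detℕ K (A (suc N))
        ≈⟨ detℕ-linear K K′ (A (suc N)) U (λ r → A N r 0) 1# (coeff N K) ℕₚ.≤-refl
             (λ r r<K → trans (lastColumn N r r<K) (+-cong (sym (*-identityˡ _)) refl)) ⟩
      1# ⊗ detℕ K (setCol (A (suc N)) K′ U) ⊕ coeff N K ⊗ detℕ K (setCol (A (suc N)) K′ (λ r → A N r 0))
        ≈⟨ +-cong (trans (*-identityˡ _) (det-otherColumns N)) (*-cong refl (det-rotatedColumns N)) ⟩
      0# ⊕ coeff N K ⊗ (sgn K′ ⊗ detℕ K (A N))
        ≈⟨ trans (+-identityˡ _) (x∙yz≈y∙xz _ _ _) ⟩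
      sgn K′ ⊗ (coeff N K ⊗ detℕ K (A N))
        ≡⟨ P.cong (λ e → sgn K′ ⊗ ((z K ⊗ q ^ e) ⊗ detℕ K (A N))) (ℕₚ.m+n∸n≡m N K′) ⟩
      sgn K′ ⊗ ((z K ⊗ q ^ N) ⊗ detℕ K (A N)) ∎
      where
      U : ℕ → Carrier
      U r = ∑ K′ (λ i → coeff N (suc i) ⊗ A (suc N) r (K′ ∸ suc i))

    det-A : ∀ N → detℕ K (A N) ≈ sgn (K′ ℕ.* N) ⊗ (z K ^ N ⊗ q ^ (N C 2))
    det-A zero    = trans det-A₀ (sym (trans (*-cong (reflexive (P.cong sgn (ℕₚ.*-zeroʳ K′))) (*-identityˡ _)) (*-identityˡ _)))
    det-A (suc N) = begin
      detℕ K (A (suc N))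
        ≈⟨ det-A-suc N ⟩
      sgn K′ ⊗ ((z K ⊗ q ^ N) ⊗ detℕ K (A N))
        ≈⟨ *-cong refl (*-cong refl (det-A N)) ⟩
      sgn K′ ⊗ ((z K ⊗ q ^ N) ⊗ (sgn (K′ ℕ.* N) ⊗ (z K ^ N ⊗ q ^ (N C 2))))
        ≈⟨ regroup _ _ _ _ _ _ ⟩
      (sgn K′ ⊗ sgn (K′ ℕ.* N)) ⊗ ((z K ⊗ z K ^ N) ⊗ (q ^ N ⊗ q ^ (N C 2)))
        ≈⟨ *-cong (sym (^-+ (- 1#) K′ _)) (*-cong refl (sym (^-+ q N _))) ⟩
      sgn (K′ + K′ ℕ.* N) ⊗ (z K ^ suc N ⊗ q ^ (N + N C 2))
        ≡⟨ P.cong₂ (λ e f → sgn e ⊗ (z K ^ suc N ⊗ q ^ f)) (P.sym (ℕₚ.*-suc K′ N)) (P.sym (suc-C2 N)) ⟩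
      sgn (K′ ℕ.* suc N) ⊗ (z K ^ suc N ⊗ q ^ (suc N C 2)) ∎
      where
      regroup : ∀ s a b t c d → s ⊗ ((a ⊗ b) ⊗ (t ⊗ (c ⊗ d))) ≈ (s ⊗ t) ⊗ ((a ⊗ c) ⊗ (b ⊗ d))
      regroup = solve 6 (λ s a b t c d → s :* ((a :* b) :* (t :* (c :* d))) := (s :* t) :* ((a :* c) :* (b :* d))) refl

  -- Identity (2): classify by the letters j before the first layer of maximal
  -- length K = K′+1 (all earlier layers are shorter):
  --   F^K_n(z) = F^{K′}_n(z) + Σ_{j ≤ n} z_K q^j F^{K′}_j(z) F^K_{n-K-j}(z ↑ K+j).
  module MaxLayer (K′ : ℕ) where
    K : ℕ
    K = suc K′

    -- the words whose first maximal layer is preceded by j letters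
    maxTerm : ℕ → (ℕ → Carrier) → ℕ → Carrier
    maxTerm n z j = z K ⊗ (q ^ j ⊗ (Fq K′ j z ⊗ Fdiff K n (K + j) (z ↑ K + j)))

    -- maxTerm with the first (short) layer, of length i+1, made explicit
    shortFirst : (ℕ → Carrier) → ℕ → ℕ → ℕ → Carrier
    shortFirst z n i j = z K ⊗ (q ^ j ⊗ ((z (suc i) ⊗ Fdiff K′ j (suc i) (z ↑ suc i)) ⊗ Fdiff K n (K + j) (z ↑ K + j)))

    -- a first layer of length i+1 needs j ≥ i+1
    shortFirst-below : ∀ z n i j → j < suc i → shortFirst z n i j ≈ 0#
    shortFirst-below z n i j j<ℓ rewrite Fdiff-> K′ j (suc i) (z ↑ suc i) j<ℓ =
      vanish (trans (*-cong (zeroʳ _) refl) (zeroˡ _))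

    -- j = 0: the first layer itself is maximal
    maxTerm-zero : ∀ n z → maxTerm n z 0 ≈ z K ⊗ Fdiff K n K (z ↑ K)
    maxTerm-zero n z = trans (*-cong refl (trans (*-identityˡ _) (trans (*-cong (F-zero K′ z) refl) (*-identityˡ _))))
                             (reflexive (P.cong (λ e → z K ⊗ Fdiff K n e (z ↑ e)) (ℕₚ.+-identityʳ K)))

    maxTerm-suc : ∀ n z j → maxTerm n z (suc j) ≈ ∑ K′ (λ i → shortFirst z n i (suc j))
    maxTerm-suc n z j = begin
      z K ⊗ (q ^ suc j ⊗ (Fq K′ (suc j) z ⊗ D))
        ≈⟨ *-cong refl (*-cong refl (*-cong (F-firstLayer K′ j z) refl)) ⟩
      z K ⊗ (q ^ suc j ⊗ (∑ K′ first ⊗ D))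
        ≈⟨ *-cong refl (*-cong refl (sym (∑-*ʳ K′ D first))) ⟩
      z K ⊗ (q ^ suc j ⊗ ∑ K′ (λ i → first i ⊗ D))
        ≈⟨ *-cong refl (sym (∑-*ˡ K′ _ _)) ⟩
      z K ⊗ ∑ K′ (λ i → q ^ suc j ⊗ (first i ⊗ D))
        ≈⟨ sym (∑-*ˡ K′ _ _) ⟩
      ∑ K′ (λ i → shortFirst z n i (suc j)) ∎
      where
      D : Carrier
      D = Fdiff K n (K + suc j) (z ↑ K + suc j)
      first : ℕ → Carrier
      first i = z (suc i) ⊗ Fdiff K′ (suc j) (suc i) (z ↑ suc i)

    maxTerm-prepend : ∀ z n′ i j → i ≤ n′ →
      z (suc i) ⊗ maxTerm (n′ ∸ i) (z ↑ suc i) j ≈ shortFirst z (suc n′) i (suc i + j)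
    maxTerm-prepend z n′ i j i≤n′ = begin
      z ℓ ⊗ ((z K ⊗ q ^ ℓ) ⊗ (q ^ j ⊗ (Fq K′ j w ⊗ Fdiff K m (K + j) (w ↑ K + j))))
        ≈⟨ regroup _ _ _ _ _ _ ⟩
      z K ⊗ ((q ^ ℓ ⊗ q ^ j) ⊗ ((z ℓ ⊗ Fq K′ j w) ⊗ Fdiff K m (K + j) (w ↑ K + j)))
        ≈⟨ *-cong refl (*-cong (sym (^-+ q ℓ j)) (*-cong (*-cong refl (reflexive short)) long)) ⟩
      shortFirst z (suc n′) i (ℓ + j) ∎
      where
      ℓ m : ℕ
      ℓ = suc i
      m = n′ ∸ i
      w : ℕ → Carrier
      w = z ↑ ℓ
      regroup : ∀ zl zK ql qj Fj D → zl ⊗ ((zK ⊗ ql) ⊗ (qj ⊗ (Fj ⊗ D))) ≈ zK ⊗ ((ql ⊗ qj) ⊗ ((zl ⊗ Fj) ⊗ D))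
      regroup = solve 6 (λ zl zK ql qj Fj D → zl :* ((zK :* ql) :* (qj :* (Fj :* D))) := zK :* ((ql :* qj) :* ((zl :* Fj) :* D))) refl
      short : Fq K′ j w ≡ Fdiff K′ (ℓ + j) ℓ w
      short = P.sym (P.trans (Fdiff-≤ K′ (ℓ + j) ℓ w (ℕₚ.m≤m+n ℓ j)) (P.cong (λ x → Fq K′ x w) (ℕₚ.m+n∸m≡n ℓ j)))
      K+ℓ+j : K + (ℓ + j) ≡ ℓ + (K + j)
      K+ℓ+j = P.trans (P.sym (ℕₚ.+-assoc K ℓ j)) (P.trans (P.cong (_+ j) (ℕₚ.+-comm K ℓ)) (ℕₚ.+-assoc ℓ K j))
      long : Fdiff K m (K + j) (w ↑ K + j) ≈ Fdiff K (suc n′) (K + (ℓ + j)) (z ↑ K + (ℓ + j))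
      long = trans (Fdiff-cong K m (K + j) _ _ (λ x → trans (↑-↑ z ℓ (K + j) x) (reflexive (P.cong (λ e → (z ↑ e) x) (P.sym K+ℓ+j)))))
                   (reflexive (P.sym (P.trans (P.cong₂ (λ x y → Fdiff K x y (z ↑ K + (ℓ + j))) (P.cong suc (P.sym (ℕₚ.m+[n∸m]≡n i≤n′))) K+ℓ+j)
                                              (Fdiff-+ K ℓ m (K + j) _))))

    maxLayer : ∀ f n → n ≤ f → ∀ z → Fq K n z ≈ Fq K′ n z ⊕ ∑ (suc n) (maxTerm n z)
    maxLayer f zero _ z = trans (F-zero K z) (sym (trans (+-cong (F-zero K′ z) noTerm) (+-identityʳ _)))
      where
      noTerm : ∑ 1 (maxTerm 0 z) ≈ 0#
      noTerm = trans (+-cong (vanish (zeroʳ _)) refl) (+-identityʳ _)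
    maxLayer (suc f) (suc n′) (s≤s n′≤f) z = begin
      Fq K n z
        ≈⟨ F-firstLayer K n′ z ⟩
      ∑ K (λ i → z (suc i) ⊗ Fdiff K n (suc i) (z ↑ suc i))
        ≈⟨ ∑-last K′ _ ⟩
      ∑ K′ (λ i → z (suc i) ⊗ Fdiff K n (suc i) (z ↑ suc i)) ⊕ lastLayer
        ≈⟨ +-cong (trans (∑-cong K′ byFirstLayer) (∑-+ K′ short shortThenMax)) refl ⟩
      (∑ K′ short ⊕ ∑ K′ shortThenMax) ⊕ lastLayer
        ≈⟨ rearrange _ _ _ ⟩
      ∑ K′ short ⊕ (lastLayer ⊕ ∑ K′ shortThenMax)
        ≈⟨ +-cong (sym (F-firstLayer K′ n′ z)) (+-cong (sym (maxTerm-zero n z)) (sym laterMax)) ⟩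
      Fq K′ n z ⊕ (maxTerm n z 0 ⊕ ∑ n (λ j → maxTerm n z (suc j))) ∎
      where
      n : ℕ
      n = suc n′
      -- the first layer has maximal length K
      lastLayer : Carrier
      lastLayer = z K ⊗ Fdiff K n K (z ↑ K)
      -- the word uses only short layers
      short : ℕ → Carrier
      short i = z (suc i) ⊗ Fdiff K′ n (suc i) (z ↑ suc i)
      -- a short first layer, later a maximal one
      shortThenMax : ℕ → Carrier
      shortThenMax i = ∑ (suc n) (shortFirst z n i)
      rearrange : ∀ a b c → (a ⊕ b) ⊕ c ≈ a ⊕ (c ⊕ b)
      rearrange = solve 3 (λ a b c → (a :+ b) :+ c := a :+ (c :+ b)) refl
      laterMax : ∑ n (λ j → maxTerm n z (suc j)) ≈ ∑ K′ shortThenMax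
      laterMax = trans (∑-cong′ n (maxTerm-suc n z))
                   (trans (∑-comm n K′ (λ j i → shortFirst z n i (suc j)))
                          (∑-cong′ K′ (λ i → trans (sym (+-identityˡ _)) (+-cong (sym (shortFirst-below z n i 0 (s≤s z≤n))) refl))))
      byFirstLayer : ∀ i → i < K′ → z (suc i) ⊗ Fdiff K n (suc i) (z ↑ suc i) ≈ short i ⊕ shortThenMax i
      byFirstLayer i _ with i ≤? n′
      ... | no i≰n′ = trans (vanish′ (Fdiff-> K n′ i _ n′<i))
                            (sym (trans (+-cong (vanish′ (Fdiff-> K′ n′ i _ n′<i))
                                                (∑-zero (suc n) (λ j j<n → shortFirst-below z n i j (ℕₚ.<-≤-trans j<n (s≤s n′<i)))))
                                        (+-identityʳ _)))
        where
        n′<i : n′ < i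
        n′<i = ℕₚ.≰⇒> i≰n′
        vanish′ : ∀ {x y} → y ≡ 0# → x ⊗ y ≈ 0#
        vanish′ y≡0 = trans (*-cong refl (reflexive y≡0)) (zeroʳ _)
      ... | yes i≤n′ = begin
          z ℓ ⊗ Fdiff K n′ i w
            ≡⟨ P.cong (z ℓ ⊗_) (Fdiff-≤ K n′ i w i≤n′) ⟩
          z ℓ ⊗ Fq K m w
            ≈⟨ *-cong refl (maxLayer f m (ℕₚ.≤-trans (ℕₚ.m∸n≤m n′ i) n′≤f) w) ⟩
          z ℓ ⊗ (Fq K′ m w ⊕ ∑ (suc m) (maxTerm m w))
            ≈⟨ distribˡ _ _ _ ⟩
          z ℓ ⊗ Fq K′ m w ⊕ z ℓ ⊗ ∑ (suc m) (maxTerm m w)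
            ≈⟨ +-cong (reflexive (P.cong (z ℓ ⊗_) (P.sym (Fdiff-≤ K′ n′ i w i≤n′)))) prepend ⟩
          short i ⊕ shortThenMax i ∎
        where
        ℓ m : ℕ
        ℓ = suc i
        m = n′ ∸ i
        w : ℕ → Carrier
        w = z ↑ ℓ
        prepend : z ℓ ⊗ ∑ (suc m) (maxTerm m w) ≈ shortThenMax i
        prepend = begin
          z ℓ ⊗ ∑ (suc m) (maxTerm m w)                            ≈⟨ sym (∑-*ˡ (suc m) (z ℓ) (maxTerm m w)) ⟩
          ∑ (suc m) (λ j → z ℓ ⊗ maxTerm m w j)                    ≈⟨ ∑-cong′ (suc m) (λ j → maxTerm-prepend z n′ i j i≤n′) ⟩
          ∑ (suc m) (λ j → shortFirst z n i (ℓ + j))               ≈⟨ sym (+-identityˡ _) ⟩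
          0# ⊕ ∑ (suc m) (λ j → shortFirst z n i (ℓ + j))          ≈⟨ +-cong (sym (∑-zero ℓ (λ j j<ℓ → shortFirst-below z n i j j<ℓ))) refl ⟩
          ∑ ℓ (shortFirst z n i) ⊕ ∑ (suc m) (λ j → shortFirst z n i (ℓ + j)) ≈⟨ sym (∑-split ℓ (suc m) (shortFirst z n i)) ⟩
          ∑ (ℓ + suc m) (shortFirst z n i)                         ≡⟨ P.cong (λ e → ∑ e (shortFirst z n i)) ℓ+m+1≡n+1 ⟩
          shortThenMax i                                           ∎
          where
          ℓ+m+1≡n+1 : ℓ + suc m ≡ suc n
          ℓ+m+1≡n+1 = P.cong suc (P.trans (ℕₚ.+-suc i m) (P.cong suc (ℕₚ.m+[n∸m]≡n i≤n′)))

  -- Identity (1): classify the words of length m+n by the layer covering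
  -- position m+1, if it does not start there.  That layer has length a+1 and
  -- b+1 of its letters lie among the first m.
  module Split (K : ℕ) where

    crossTerm : ℕ → ℕ → (ℕ → Carrier) → ℕ → ℕ → Carrier
    crossTerm m n z a b =
      z (suc a) ⊗ (q ^ (m ∸ suc b) ⊗ (Fdiff K m (suc b) z ⊗ Fdiff K (n + suc b) (suc a) (z ↑ m + suc a ∸ suc b)))

    splitRHS : ℕ → ℕ → (ℕ → Carrier) → Carrier
    splitRHS m n z = Fq K m z ⊗ Fq K n (z ↑ m) ⊕ ∑ K (λ a → ∑ a (crossTerm m n z a))

    -- Refinements by the first layer i+1: it ends before position m+1 ...
    beforeCross : ℕ → ℕ → (ℕ → Carrier) → ℕ → Carrier
    beforeCross m n z i = (z (suc i) ⊗ Fdiff K m (suc i) (z ↑ suc i)) ⊗ Fq K n (z ↑ m)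

    -- ... it precedes the crossing layer ...
    crossLater : ℕ → ℕ → (ℕ → Carrier) → ℕ → ℕ → ℕ → Carrier
    crossLater m n z i a b = z (suc i) ⊗ (z (suc a) ⊗ (q ^ (m ∸ suc b) ⊗
      (Fdiff K m (suc b + suc i) (z ↑ suc i) ⊗ Fdiff K (n + suc b) (suc a) (z ↑ m + suc a ∸ suc b))))

    -- ... or it is the crossing layer.
    crossFirst : ℕ → ℕ → (ℕ → Carrier) → ℕ → ℕ → Carrier
    crossFirst m n z a b = z (suc a) ⊗ (q ^ (m ∸ suc b) ⊗ (δ m (suc b) ⊗ Fdiff K (n + suc b) (suc a) (z ↑ m + suc a ∸ suc b)))

    -- splitting the part of length m-b-1 before the crossing layer by its first layer
    crossTerm-firstLayer : ∀ m n z a b → crossTerm m n z a b ≈ crossFirst m n z a b ⊕ ∑ K (λ i → crossLater m n z i a b)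
    crossTerm-firstLayer m n z a b = begin
      z (suc a) ⊗ (q ^ (m ∸ suc b) ⊗ (Fdiff K m (suc b) z ⊗ D))
        ≈⟨ *-cong refl (*-cong refl (*-cong (Fdiff-firstLayer K m (suc b) z) refl)) ⟩
      z (suc a) ⊗ (q ^ (m ∸ suc b) ⊗ ((δ m (suc b) ⊕ ∑ K g) ⊗ D))
        ≈⟨ distribute _ _ _ _ _ ⟩
      crossFirst m n z a b ⊕ z (suc a) ⊗ (q ^ (m ∸ suc b) ⊗ (∑ K g ⊗ D))
        ≈⟨ +-cong refl (trans (*-cong refl (*-cong refl (sym (∑-*ʳ K D g)))) (trans (*-cong refl (sym (∑-*ˡ K _ _))) (sym (∑-*ˡ K _ _)))) ⟩
      crossFirst m n z a b ⊕ ∑ K (λ i → z (suc a) ⊗ (q ^ (m ∸ suc b) ⊗ (g i ⊗ D)))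
        ≈⟨ +-cong refl (∑-cong′ K (λ i → shuffle _ _ _ _ _)) ⟩
      crossFirst m n z a b ⊕ ∑ K (λ i → crossLater m n z i a b) ∎
      where
      D : Carrier
      D = Fdiff K (n + suc b) (suc a) (z ↑ m + suc a ∸ suc b)
      g : ℕ → Carrier
      g i = z (suc i) ⊗ Fdiff K m (suc b + suc i) (z ↑ suc i)
      distribute : ∀ y p x s d → y ⊗ (p ⊗ ((x ⊕ s) ⊗ d)) ≈ y ⊗ (p ⊗ (x ⊗ d)) ⊕ y ⊗ (p ⊗ (s ⊗ d))
      distribute = solve 5 (λ y p x s d → y :* (p :* ((x :+ s) :* d)) := y :* (p :* (x :* d)) :+ y :* (p :* (s :* d))) refl
      shuffle : ∀ y p zl f d → y ⊗ (p ⊗ ((zl ⊗ f) ⊗ d)) ≈ zl ⊗ (y ⊗ (p ⊗ (f ⊗ d)))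
      shuffle = solve 5 (λ y p zl f d → y :* (p :* ((zl :* f) :* d)) := zl :* (y :* (p :* (f :* d)))) refl

    splitRHS-byFirstLayer : ∀ m′ n z → let m = suc m′ in
      splitRHS m n z ≈ ∑ K (λ i → beforeCross m n z i ⊕ (∑ K (λ a → ∑ a (crossLater m n z i a)) ⊕ ∑ i (crossFirst m n z i)))
    splitRHS-byFirstLayer m′ n z = begin
      Fq K m z ⊗ Fq K n (z ↑ m) ⊕ ∑ K (λ a → ∑ a (crossTerm m n z a))
        ≈⟨ +-cong (trans (*-cong (F-firstLayer K m′ z) refl) (sym (∑-*ʳ K _ _))) crossing ⟩
      ∑ K (beforeCross m n z) ⊕ (∑ K (λ a → ∑ a (crossFirst m n z a)) ⊕ ∑ K (λ i → ∑ K (λ a → ∑ a (crossLater m n z i a))))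
        ≈⟨ +-cong refl (+-comm _ _) ⟩
      ∑ K (beforeCross m n z) ⊕ (∑ K (λ i → ∑ K (λ a → ∑ a (crossLater m n z i a))) ⊕ ∑ K (λ a → ∑ a (crossFirst m n z a)))
        ≈⟨ sym (trans (∑-+ K _ _) (+-cong refl (∑-+ K _ _))) ⟩
      ∑ K (λ i → beforeCross m n z i ⊕ (∑ K (λ a → ∑ a (crossLater m n z i a)) ⊕ ∑ i (crossFirst m n z i))) ∎
      where
      m : ℕ
      m = suc m′
      crossing : ∑ K (λ a → ∑ a (crossTerm m n z a))
                 ≈ ∑ K (λ a → ∑ a (crossFirst m n z a)) ⊕ ∑ K (λ i → ∑ K (λ a → ∑ a (crossLater m n z i a)))
      crossing = begin
        ∑ K (λ a → ∑ a (crossTerm m n z a))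
          ≈⟨ ∑-cong′ K (λ a → trans (∑-cong′ a (crossTerm-firstLayer m n z a)) (∑-+ a _ _)) ⟩
        ∑ K (λ a → ∑ a (crossFirst m n z a) ⊕ ∑ a (λ b → ∑ K (λ i → crossLater m n z i a b)))
          ≈⟨ ∑-+ K _ _ ⟩
        ∑ K (λ a → ∑ a (crossFirst m n z a)) ⊕ ∑ K (λ a → ∑ a (λ b → ∑ K (λ i → crossLater m n z i a b)))
          ≈⟨ +-cong refl (trans (∑-cong′ K (λ a → ∑-comm a K (λ b i → crossLater m n z i a b)))
                                (∑-comm K K (λ a i → ∑ a (crossLater m n z i a)))) ⟩
        ∑ K (λ a → ∑ a (crossFirst m n z a)) ⊕ ∑ K (λ i → ∑ K (λ a → ∑ a (crossLater m n z i a))) ∎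

    byFirst : ℕ → ℕ → (ℕ → Carrier) → ℕ → Carrier
    byFirst m n z i = beforeCross m n z i ⊕ (∑ K (λ a → ∑ a (crossLater m n z i a)) ⊕ ∑ i (crossFirst m n z i))

    -- A first layer longer than m is the crossing layer.
    firstLayer-crosses : ∀ m′ n z i → m′ < i → z (suc i) ⊗ Fdiff K (suc m′ + n) (suc i) (z ↑ suc i) ≈ byFirst (suc m′) n z i
    firstLayer-crosses m′ n z i m′<i = sym (begin
      beforeCross m n z i ⊕ (∑ K (λ a → ∑ a (crossLater m n z i a)) ⊕ ∑ i (crossFirst m n z i))
        ≈⟨ +-cong noBefore (+-cong (∑-zero K (λ a _ → ∑-zero a (λ b _ → noLater a b))) (∑-single i m′ m′<i notCrossing)) ⟩
      0# ⊕ (0# ⊕ crossFirst m n z i m′)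
        ≈⟨ trans (+-identityˡ _) (+-identityˡ _) ⟩
      crossFirst m n z i m′
        ≈⟨ crossing ⟩
      z (suc i) ⊗ Fdiff K (m + n) (suc i) (z ↑ suc i) ∎)
      where
      m : ℕ
      m = suc m′
      noBefore : beforeCross m n z i ≈ 0#
      noBefore = trans (*-cong (trans (*-cong refl (reflexive (Fdiff-> K m′ i _ m′<i))) (zeroʳ _)) refl) (zeroˡ _)
      noLater : ∀ a b → crossLater m n z i a b ≈ 0#
      noLater a b rewrite Fdiff-> K m (suc b + suc i) (z ↑ suc i) (ℕₚ.≤-trans (s≤s m′<i) (ℕₚ.m≤n+m (suc i) (suc b))) =
        vanish (trans (*-cong refl (zeroˡ _)) (zeroʳ _))
      notCrossing : ∀ b → b < i → b ≢ m′ → crossFirst m n z i b ≈ 0#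
      notCrossing b _ b≢m′ = vanish (trans (*-cong (δ-≢ m′ b (λ e → b≢m′ (P.sym e))) refl) (zeroˡ _))
      crossing : crossFirst m n z i m′ ≈ z (suc i) ⊗ Fdiff K (m + n) (suc i) (z ↑ suc i)
      crossing = trans (*-cong refl (trans (*-cong (reflexive (P.cong (q ^_) (ℕₚ.n∸n≡0 m)))
                                                   (trans (*-cong (δ-refl m) refl) (*-identityˡ _))) (*-identityˡ _)))
                       (*-cong refl (reflexive (P.cong₂ (λ x e → Fdiff K x (suc i) (z ↑ e)) (ℕₚ.+-comm n m) (ℕₚ.m+n∸m≡n m (suc i)))))

    crossTerm-prepend : ∀ m′ n z i a b → i ≤ m′ → b < a →
      z (suc i) ⊗ crossTerm (m′ ∸ i) n (z ↑ suc i) a b ≈ crossLater (suc m′) n z i a b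
    crossTerm-prepend m′ n z i a b i≤m′ b<a = begin
      z ℓ ⊗ ((z (suc a) ⊗ q ^ ℓ) ⊗ (q ^ (m₁ ∸ suc b) ⊗ (Fdiff K m₁ (suc b) w ⊗ D₁)))
        ≈⟨ shuffle₁ _ _ _ _ _ _ ⟩
      z ℓ ⊗ (z (suc a) ⊗ ((q ^ ℓ ⊗ (q ^ (m₁ ∸ suc b) ⊗ Fdiff K m₁ (suc b) w)) ⊗ D₁))
        ≈⟨ *-cong refl (*-cong refl (*-cong powers shifts)) ⟩
      z ℓ ⊗ (z (suc a) ⊗ ((q ^ (m ∸ suc b) ⊗ Fdiff K m (suc b + ℓ) w) ⊗ D₂))
        ≈⟨ shuffle₂ _ _ _ _ _ ⟩
      crossLater m n z i a b ∎
      where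
      ℓ m m₁ : ℕ
      ℓ = suc i
      m = suc m′
      m₁ = m′ ∸ i
      w : ℕ → Carrier
      w = z ↑ ℓ
      m≡ℓ+m₁ : m ≡ ℓ + m₁
      m≡ℓ+m₁ = P.cong suc (P.sym (ℕₚ.m+[n∸m]≡n i≤m′))
      D₁ D₂ : Carrier
      D₁ = Fdiff K (n + suc b) (suc a) (w ↑ m₁ + suc a ∸ suc b)
      D₂ = Fdiff K (n + suc b) (suc a) (z ↑ m + suc a ∸ suc b)
      shuffle₁ : ∀ zl z′ ql p f d → zl ⊗ ((z′ ⊗ ql) ⊗ (p ⊗ (f ⊗ d))) ≈ zl ⊗ (z′ ⊗ ((ql ⊗ (p ⊗ f)) ⊗ d))
      shuffle₁ = solve 6 (λ zl z′ ql p f d → zl :* ((z′ :* ql) :* (p :* (f :* d))) := zl :* (z′ :* ((ql :* (p :* f)) :* d))) refl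
      shuffle₂ : ∀ zl z′ p f d → zl ⊗ (z′ ⊗ ((p ⊗ f) ⊗ d)) ≈ zl ⊗ (z′ ⊗ (p ⊗ (f ⊗ d)))
      shuffle₂ = solve 5 (λ zl z′ p f d → zl :* (z′ :* ((p :* f) :* d)) := zl :* (z′ :* (p :* (f :* d)))) refl
      sameF : Fdiff K m (ℓ + suc b) w ≡ Fdiff K m₁ (suc b) w
      sameF = P.trans (P.cong (λ x → Fdiff K x (ℓ + suc b) w) m≡ℓ+m₁) (Fdiff-+ K ℓ m₁ (suc b) w)
      sameExponent : m ∸ (ℓ + suc b) ≡ m₁ ∸ suc b
      sameExponent = P.trans (P.sym (ℕₚ.∸-+-assoc m ℓ (suc b))) (P.cong (_∸ suc b) (P.trans (P.cong (_∸ ℓ) m≡ℓ+m₁) (ℕₚ.m+n∸m≡n ℓ m₁)))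
      powers : q ^ ℓ ⊗ (q ^ (m₁ ∸ suc b) ⊗ Fdiff K m₁ (suc b) w) ≈ q ^ (m ∸ suc b) ⊗ Fdiff K m (suc b + ℓ) w
      powers = P.subst₂ (λ e x → q ^ ℓ ⊗ (q ^ e ⊗ x) ≈ q ^ (m ∸ suc b) ⊗ Fdiff K m (suc b + ℓ) w) sameExponent sameF
                 (trans (q^-absorb K m ℓ (suc b) w) (reflexive (P.cong (λ e → q ^ (m ∸ suc b) ⊗ Fdiff K m e w) (ℕₚ.+-comm ℓ (suc b)))))
      shiftExponent : ℓ + (m₁ + suc a ∸ suc b) ≡ m + suc a ∸ suc b
      shiftExponent = P.trans (P.sym (ℕₚ.+-∸-assoc ℓ (ℕₚ.≤-trans b<a (ℕₚ.≤-trans (ℕₚ.n≤1+n a) (ℕₚ.m≤n+m (suc a) m₁)))))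
                              (P.cong (_∸ suc b) (P.trans (P.sym (ℕₚ.+-assoc ℓ m₁ (suc a))) (P.cong (_+ suc a) (P.sym m≡ℓ+m₁))))
      shifts : D₁ ≈ D₂
      shifts = Fdiff-cong K (n + suc b) (suc a) _ _ (λ x → trans (↑-↑ z ℓ _ x) (reflexive (P.cong (λ e → (z ↑ e) x) shiftExponent)))

    -- A first layer i+1 ≤ m: the rest is a word of length (m-i-1)+n, split by induction.
    firstLayer-inside : ∀ m′ n z i → i ≤ m′ → let w = z ↑ suc i in
      Fq K ((m′ ∸ i) + n) w ≈ splitRHS (m′ ∸ i) n w →
      z (suc i) ⊗ Fdiff K (m′ + n) i w ≈ byFirst (suc m′) n z i
    firstLayer-inside m′ n z i i≤m′ IH = begin
      z ℓ ⊗ Fdiff K (m′ + n) i w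
        ≡⟨ P.cong (z ℓ ⊗_) (P.trans (Fdiff-≤ K (m′ + n) i w (ℕₚ.≤-trans i≤m′ (ℕₚ.m≤m+n m′ n)))
                                    (P.cong (λ x → Fq K x w) (ℕₚ.+-∸-comm n i≤m′))) ⟩
      z ℓ ⊗ Fq K (m₁ + n) w
        ≈⟨ *-cong refl IH ⟩
      z ℓ ⊗ (Fq K m₁ w ⊗ Fq K n (w ↑ m₁) ⊕ ∑ K (λ a → ∑ a (crossTerm m₁ n w a)))
        ≈⟨ distribˡ _ _ _ ⟩
      z ℓ ⊗ (Fq K m₁ w ⊗ Fq K n (w ↑ m₁)) ⊕ z ℓ ⊗ ∑ K (λ a → ∑ a (crossTerm m₁ n w a))
        ≈⟨ +-cong before (trans later (sym (+-identityʳ _))) ⟩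
      beforeCross m n z i ⊕ (∑ K (λ a → ∑ a (crossLater m n z i a)) ⊕ 0#)
        ≈⟨ +-cong refl (+-cong refl (sym (∑-zero i notCrossing))) ⟩
      byFirst m n z i ∎
      where
      ℓ m m₁ : ℕ
      ℓ = suc i
      m = suc m′
      m₁ = m′ ∸ i
      w : ℕ → Carrier
      w = z ↑ ℓ
      before : z ℓ ⊗ (Fq K m₁ w ⊗ Fq K n (w ↑ m₁)) ≈ beforeCross m n z i
      before = trans (sym (*-assoc _ _ _)) (*-cong (*-cong refl (reflexive (P.sym (Fdiff-≤ K m′ i w i≤m′))))
                 (F-cong K n _ _ (λ x → trans (↑-↑ z ℓ m₁ x) (reflexive (P.cong (λ e → (z ↑ e) x) (P.cong suc (ℕₚ.m+[n∸m]≡n i≤m′)))))))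
      later : z ℓ ⊗ ∑ K (λ a → ∑ a (crossTerm m₁ n w a)) ≈ ∑ K (λ a → ∑ a (crossLater m n z i a))
      later = trans (sym (∑-*ˡ K (z ℓ) _))
                (∑-cong′ K (λ a → trans (sym (∑-*ˡ a (z ℓ) _)) (∑-cong a (λ b b<a → crossTerm-prepend m′ n z i a b i≤m′ b<a))))
      notCrossing : ∀ b → b < i → crossFirst m n z i b ≈ 0#
      notCrossing b b<i = vanish (trans (*-cong (δ-≢ m′ b (λ e → ℕₚ.<-irrefl (P.sym e) (ℕₚ.<-≤-trans b<i i≤m′))) refl) (zeroˡ _))

    split : ∀ f m → m ≤ f → ∀ n z → Fq K (m + n) z ≈ splitRHS m n z
    split f zero _ n z = sym (trans (+-cong (trans (*-cong (F-zero K z) (F-cong K n _ _ (λ _ → *-identityʳ _))) (*-identityˡ _))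
                                           (∑-zero K (λ a _ → ∑-zero a (λ b _ → vanish (zeroˡ _)))))
                                    (+-identityʳ _))
    split (suc f) (suc m′) (s≤s m′≤f) n z = begin
      Fq K (suc m′ + n) z
        ≈⟨ F-firstLayer K (m′ + n) z ⟩
      ∑ K (λ i → z (suc i) ⊗ Fdiff K (suc m′ + n) (suc i) (z ↑ suc i))
        ≈⟨ ∑-cong′ K (λ i → byLength i (i ≤? m′)) ⟩
      ∑ K (byFirst (suc m′) n z)
        ≈⟨ sym (splitRHS-byFirstLayer m′ n z) ⟩
      splitRHS (suc m′) n z ∎
      where
      byLength : ∀ i → Dec (i ≤ m′) → z (suc i) ⊗ Fdiff K (suc m′ + n) (suc i) (z ↑ suc i) ≈ byFirst (suc m′) n z i
      byLength i (no i≰m′) = firstLayer-crosses m′ n z i (ℕₚ.≰⇒> i≰m′)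
      byLength i (yes i≤m′) = firstLayer-inside m′ n z i i≤m′ (split f (m′ ∸ i) (ℕₚ.≤-trans (ℕₚ.m∸n≤m m′ i) m′≤f) n (z ↑ suc i))

  Fℤ≡Fdiff : ∀ K a b w → Fℤ R K (+ a -ℤ + b) w q ≡ Fdiff K a b w
  Fℤ≡Fdiff K a b w with b ≤? a
  ... | yes b≤a = P.trans (P.cong (λ x → Fℤ R K x w q) (P.trans (ℤₚ.m-n≡m⊖n a b) (ℤₚ.⊖-≥ b≤a)))
                          (P.sym (Fdiff-≤ K a b w b≤a))
  ... | no b≰a = P.trans (P.cong (λ x → Fℤ R K x w q) (P.trans (ℤₚ.m-n≡m⊖n a b) (ℤₚ.⊖-< a<b)))
                         (P.trans (negative (b ∸ a) (ℕₚ.m<n⇒0<n∸m a<b)) (P.sym (Fdiff-> K a b w a<b)))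
    where
    a<b : a < b
    a<b = ℕₚ.≰⇒> b≰a
    negative : ∀ d → 0 < d → Fℤ R K (-ℤ (+ d)) w q ≡ 0#
    negative (suc d) _ = P.refl

  sumℤ≈∑ : ∀ n k (f : ℕ → Carrier) → (∀ j → n < k + j → f j ≈ 0#) → sumℤ R 0 (+ n -ℤ + k) f ≈ ∑ (suc n) f
  sumℤ≈∑ n k f beyond with k ≤? n
  ... | yes k≤n = begin
        sumℤ R 0 (+ n -ℤ + k) f                ≡⟨ P.cong (λ x → sumℤ R 0 x f) (P.trans (ℤₚ.m-n≡m⊖n n k) (ℤₚ.⊖-≥ k≤n)) ⟩
        sumFromTo R 0 (n ∸ k) f                ≈⟨ sumFromTo≈∑ 0 (n ∸ k) f ⟩
        ∑ (suc (n ∸ k)) f                      ≈⟨ sym (+-identityʳ _) ⟩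
        ∑ (suc (n ∸ k)) f ⊕ 0#                 ≈⟨ +-cong refl (sym (∑-zero k (λ i _ → beyond _ (tail i)))) ⟩
        ∑ (suc (n ∸ k)) f ⊕ ∑ k (λ i → f (suc (n ∸ k) + i)) ≈⟨ sym (∑-split (suc (n ∸ k)) k f) ⟩
        ∑ (suc (n ∸ k) + k) f                  ≡⟨ P.cong (λ e → ∑ (suc e) f) (ℕₚ.m∸n+n≡m k≤n) ⟩
        ∑ (suc n) f                            ∎
    where
    tail : ∀ i → n < k + (suc (n ∸ k) + i)
    tail i = ℕₚ.≤-trans (s≤s (ℕₚ.≤-trans (ℕₚ.≤-reflexive (P.sym (ℕₚ.m+[n∸m]≡n k≤n))) (ℕₚ.+-monoʳ-≤ k (ℕₚ.m≤m+n (n ∸ k) i))))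
                        (ℕₚ.≤-reflexive (P.sym (ℕₚ.+-suc k (n ∸ k + i))))
  ... | no k≰n = begin
        sumℤ R 0 (+ n -ℤ + k) f                ≡⟨ P.cong (λ x → sumℤ R 0 x f) (P.trans (ℤₚ.m-n≡m⊖n n k) (ℤₚ.⊖-< n<k)) ⟩
        sumℤ R 0 (-ℤ (+ (k ∸ n))) f            ≡⟨ empty (k ∸ n) (ℕₚ.m<n⇒0<n∸m n<k) ⟩
        0#                                     ≈⟨ sym (∑-zero (suc n) (λ j _ → beyond j (ℕₚ.<-≤-trans n<k (ℕₚ.m≤m+n k j)))) ⟩
        ∑ (suc n) f                            ∎
    where
    n<k : n < k
    n<k = ℕₚ.≰⇒> k≰n
    empty : ∀ d → 0 < d → sumℤ R 0 (-ℤ (+ d)) f ≡ 0#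
    empty (suc d) _ = P.refl

  ℤ-sub-sub : ∀ n k j → + n -ℤ + k -ℤ + j ≡ + n -ℤ + (k + j)
  ℤ-sub-sub n k j = P.trans (ℤₚ.+-assoc (+ n) (-ℤ (+ k)) (-ℤ (+ j)))
    (P.cong (λ x → + n +ℤ x) (P.trans (P.sym (ℤₚ.neg-distrib-+ (+ k) (+ j))) (P.cong -ℤ_ (P.sym (ℤₚ.pos-+ k j)))))

  ℤ-sub-add : ∀ n i j → + n -ℤ + i +ℤ + j ≡ + (n + j) -ℤ + i
  ℤ-sub-add n i j = P.trans (ℤₚ.+-assoc (+ n) (-ℤ (+ i)) (+ j))
    (P.trans (P.cong (λ x → + n +ℤ x) (ℤₚ.+-comm (-ℤ (+ i)) (+ j)))
      (P.trans (P.sym (ℤₚ.+-assoc (+ n) (+ j) (-ℤ (+ i)))) (P.cong (λ x → x +ℤ -ℤ (+ i)) (P.sym (ℤₚ.pos-+ n j)))))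

  identity₁ : ∀ K′ z m n →
    Fq (suc K′) (m + n) z ≈ Fq (suc K′) m z ⊗ Fq (suc K′) n (z ↑ m) ⊕
      sumℤ R 2 (+ suc K′) (λ i → sumℤ R 1 (+ i -ℤ + 1) (λ j →
        z i ⊗ (q ^ (m ∸ j) ⊗ (Fℤ R (suc K′) (+ m -ℤ + j) z q ⊗ Fℤ R (suc K′) (+ n -ℤ + i +ℤ + j) (z ↑ m + i ∸ j) q))))
  identity₁ K′ z m n = trans (split m m ℕₚ.≤-refl n z) (+-cong refl (sym outer))
    where
    open Split (suc K′)
    term : ℕ → ℕ → Carrier
    term i j = z i ⊗ (q ^ (m ∸ j) ⊗ (Fℤ R (suc K′) (+ m -ℤ + j) z q ⊗ Fℤ R (suc K′) (+ n -ℤ + i +ℤ + j) (z ↑ m + i ∸ j) q))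
    termℕ : ∀ a b → term (suc (suc a)) (suc b) ≈ crossTerm m n z (suc a) b
    termℕ a b = reflexive (P.cong₂ (λ u v → z (suc (suc a)) ⊗ (q ^ (m ∸ suc b) ⊗ (u ⊗ v)))
      (Fℤ≡Fdiff (suc K′) m (suc b) z)
      (P.trans (P.cong (λ e → Fℤ R (suc K′) e (z ↑ m + suc (suc a) ∸ suc b) q) (ℤ-sub-add n (suc (suc a)) (suc b)))
               (Fℤ≡Fdiff (suc K′) (n + suc b) (suc (suc a)) _)))
    inner : ∀ a → sumℤ R 1 (+ suc (suc a) -ℤ + 1) (term (suc (suc a))) ≈ ∑ (suc a) (crossTerm m n z (suc a))
    inner a = trans (sumFromTo≈∑ 1 (suc a) (term (suc (suc a)))) (∑-cong′ (suc a) (termℕ a))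
    outer : sumℤ R 2 (+ suc K′) (λ i → sumℤ R 1 (+ i -ℤ + 1) (term i)) ≈ ∑ (suc K′) (λ a → ∑ a (crossTerm m n z a))
    outer = trans (sumFromTo≈∑ 2 (suc K′) (λ i → sumℤ R 1 (+ i -ℤ + 1) (term i))) (trans (∑-cong′ K′ inner) (sym (+-identityˡ _)))

  identity₂ : ∀ K′ z n →
    Fq (suc K′) n z ≈ Fq K′ n z ⊕ sumℤ R 0 (+ n -ℤ + suc K′) (λ j →
      z (suc K′) ⊗ (q ^ j ⊗ (Fq K′ j z ⊗ Fℤ R (suc K′) (+ n -ℤ + suc K′ -ℤ + j) (z ↑ suc K′ + j) q)))
  identity₂ K′ z n = trans (maxLayer n n ℕₚ.≤-refl z) (+-cong refl (sym (trans (sumℤ≈∑ n K _ beyond) (∑-cong′ (suc n) same))))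
    where
    open MaxLayer K′
    same : ∀ j → z K ⊗ (q ^ j ⊗ (Fq K′ j z ⊗ Fℤ R K (+ n -ℤ + K -ℤ + j) (z ↑ K + j) q)) ≈ maxTerm n z j
    same j = reflexive (P.cong (λ x → z K ⊗ (q ^ j ⊗ (Fq K′ j z ⊗ x)))
               (P.trans (P.cong (λ x → Fℤ R K x (z ↑ K + j) q) (ℤ-sub-sub n K j)) (Fℤ≡Fdiff K n (K + j) (z ↑ K + j))))
    beyond : ∀ j → n < K + j → z K ⊗ (q ^ j ⊗ (Fq K′ j z ⊗ Fℤ R K (+ n -ℤ + K -ℤ + j) (z ↑ K + j) q)) ≈ 0#
    beyond j n<K+j = trans (same j) (vanish (trans (*-cong refl (reflexive (Fdiff-> K n (K + j) _ n<K+j))) (zeroʳ _)))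

  identity₃ : ∀ K′ z N → K′ ≤ N →
    det R (suc K′) (λ s t → Fq (suc K′) (N + toℕ t ∸ toℕ s) (z ↑ toℕ s))
      ≈ signPow R (K′ ℕ.* N) ⊗ (z (suc K′) ^ N ⊗ q ^ (N C 2))
  identity₃ K′ z N K′≤N = trans (det≈detℕ K _ (A N) entries) (det-A N)
    where
    open Hankel K′ z
    entries : ∀ (s t : Fin K) → Fq K (N + toℕ t ∸ toℕ s) (z ↑ toℕ s) ≈ A N (toℕ s) (toℕ t)
    entries s t = reflexive (P.sym (Fdiff-≤ K (N + toℕ t) (toℕ s) (z ↑ toℕ s)
      (ℕₚ.≤-trans (ℕₚ.≤-pred (toℕ<n s)) (ℕₚ.≤-trans K′≤N (ℕₚ.m≤m+n N (toℕ t))))))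

  hankel-odd : ∀ K′ z n′ → ¬ (2 ∣ suc K′) →
    det R (suc K′) (λ s t → Fq (suc K′) (suc n′ + suc K′ ∸ 1 + toℕ t ∸ toℕ s) (z ↑ toℕ s))
      ≈ z (suc K′) ^ (suc n′ + suc K′ ∸ 1) ⊗ q ^ ((suc n′ + suc K′ ∸ 1) C 2)
  hankel-odd K′ z n′ k-odd with parity K′
  ... | inj₂ (m , K′≡2m+1) = ⊥-elim (k-odd (divides (suc m) (P.trans (P.cong suc K′≡2m+1) (k≡ m))))
    where
    k≡ : ∀ m → suc (suc (m + m)) ≡ suc m ℕ.* 2
    k≡ = solve-∀
  ... | inj₁ (m , K′≡2m) = trans (identity₃ K′ z N (ℕₚ.≤-trans (ℕₚ.n≤1+n K′) (ℕₚ.m≤n+m (suc K′) n′)))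
                                 (trans (*-cong sign refl) (*-identityˡ _))
    where
    open Signs R
    N : ℕ
    N = n′ + suc K′
    double : ∀ m N → (m + m) ℕ.* N ≡ 0 + (m ℕ.* N + m ℕ.* N)
    double = solve-∀
    sign : signPow R (K′ ℕ.* N) ≈ 1#
    sign = trans (reflexive (P.cong (signPow R) (P.trans (P.cong (ℕ._* N) K′≡2m) (double m N)))) (signPow-even 0 (m ℕ.* N))

  hankel-even : ∀ K′ z n′ → 2 ∣ suc K′ →
    det R (suc K′) (λ s t → Fq (suc K′) (suc n′ + suc K′ ∸ 1 + toℕ t ∸ toℕ s) (z ↑ toℕ s))
      ≈ signPow R n′ ⊗ (z (suc K′) ^ (suc n′ + suc K′ ∸ 1) ⊗ q ^ ((suc n′ + suc K′ ∸ 1) C 2))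
  hankel-even K′ z n′ (divides zero ())
  hankel-even K′ z n′ (divides (suc m) k≡2m+2) = trans (identity₃ K′ z N (ℕₚ.≤-trans (ℕₚ.n≤1+n K′) (ℕₚ.m≤n+m (suc K′) n′)))
                                                    (*-cong sign refl)
    where
    open Signs R
    N : ℕ
    N = n′ + suc K′
    expand : ∀ m n′ → suc (m ℕ.* 2) ℕ.* (n′ + suc (suc (m ℕ.* 2)))
                      ≡ n′ + ((1 + 3 ℕ.* m + m ℕ.* n′ + 2 ℕ.* m ℕ.* m) + (1 + 3 ℕ.* m + m ℕ.* n′ + 2 ℕ.* m ℕ.* m))
    expand = solve-∀
    K′≡2m+1 : K′ ≡ suc (m ℕ.* 2)
    K′≡2m+1 = ℕₚ.suc-injective k≡2m+2
    sign : signPow R (K′ ℕ.* N) ≈ signPow R n′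
    sign = trans (reflexive (P.cong (signPow R) (P.trans (P.cong (λ x → x ℕ.* (n′ + suc x)) K′≡2m+1) (expand m n′))))
                 (signPow-even n′ (1 + 3 ℕ.* m + m ℕ.* n′ + 2 ℕ.* m ℕ.* m))

mainTheorem13 : ∀ {c ℓ : Level} (R : CommutativeRing c ℓ) →
    (k : ℕ) → 1 ≤ k → (z : ℕ → Car R) → (q : Car R) →
    ((m n : ℕ) → 1 ≤ m → 1 ≤ n →
      Eq R (F R k (m + n) z q)
        (add R (mul R (F R k m z q) (F R k n (shift R z q m) q))
          (sumℤ R 2 (+ k) (λ i → sumℤ R 1 (+ i -ℤ + 1) (λ j →
             mul R (z i) (mul R (pow R q (m ∸ j))
               (mul R (Fℤ R k (+ m -ℤ + j) z q)
                      (Fℤ R k (+ n -ℤ + i +ℤ + j) (shift R z q (m + i ∸ j)) q))))))))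
    ×
    ((n : ℕ) → 1 ≤ n →
      Eq R (F R k n z q)
        (add R (F R (k ∸ 1) n z q)
          (sumℤ R 0 (+ n -ℤ + k) (λ j →
             mul R (z k) (mul R (pow R q j)
               (mul R (F R (k ∸ 1) j z q)
                      (Fℤ R k (+ n -ℤ + k -ℤ + j) (shift R z q (k + j)) q)))))))
    ×
    ((n : ℕ) → 1 ≤ n →
      (¬ (2 ∣ k) →
        Eq R (det R k (λ s t → F R k (n + k ∸ 1 + toℕ t ∸ toℕ s) (shift R z q (toℕ s)) q))
             (mul R (pow R (z k) (n + k ∸ 1)) (pow R q ((n + k ∸ 1) C 2))))
      ×
      (2 ∣ k →
        Eq R (det R k (λ s t → F R k (n + k ∸ 1 + toℕ t ∸ toℕ s) (shift R z q (toℕ s)) q))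
             (mul R (signPow R (n ∸ 1))
               (mul R (pow R (z k) (n + k ∸ 1)) (pow R q ((n + k ∸ 1) C 2))))))
mainTheorem13 R zero     () z q
mainTheorem13 R (suc K′) _  z q =
    (λ m n _ _ → identity₁ K′ z m n)
  , (λ n _ → identity₂ K′ z n)
  , λ { (suc n′) _ → hankel-odd K′ z n′ , hankel-even K′ z n′ }
  where open Layered R q
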